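{- For all integers $n,k\geq 0$, \begin{align*} c_{13,1}\left(2^{3k+5}n+\frac{19\cdot 2^{3k+3}+9}{7}\right)&\equiv 0\pmod 2,\\ c_{13,1}\left(2^{3k+6}n+\frac{27\cdot 2^{3k+4}+9}{7}\right)&\equiv 0\pmod 2,\\ c_{13,1}\left(2^{3k+7}n+\frac{3\cdot 2^{3k+5}+9}{7}\right)&\equiv 0\pmod 2. \end{align*}
   Context: For complex $a,b$ the false theta function is $\Psi(a,b):=\sum_{n=0}^\infty a^{n(n+1)/2}b^{n(n-1)/2}-\sum_{n=-\infty}^{ -1}a^{n(n+1)/2}b^{n(n-1)/2}$. For positive integers $r,s$, the integers $c_{r,s}(n)$ ($n\ge 0$) are defined by the power series identity $\sum_{n=0}^\infty c_{r,s}(n)q^n=\dfrac{1}{\Psi(-q^r,q^s)}$ (the denominator is a power series in $q$ with constant term $1$). -}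

module Defs where

open import Data.Nat as ℕ using (ℕ; zero; suc; _≡ᵇ_)
open import Data.Nat.DivMod using (_/_)
open import Data.Integer as ℤ using (ℤ; +_; -_)
open import Data.Bool using (if_then_else_)
open import Data.List using (List; []; _∷_; map; upTo; zipWith; foldr)
open import Data.Vec as Vec using (Vec; []; _∷_; head; toList)

sumℤ : List ℤ → ℤ
sumℤ = foldr ℤ._+_ (+ 0)

tri : ℕ → ℕ
tri n = (n ℕ.* suc n) / 2

sgn : ℕ → ℤ
sgn k = (ℤ.-1ℤ) ℤ.^ k

-- Coefficient of q^N in the power series Psi(-q^r, q^s), where
--   Psi(a,b) = Σ_{n≥0} a^{n(n+1)/2} b^{n(n-1)/2} - Σ_{n≤-1} a^{n(n+1)/2} b^{n(n-1)/2}.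
-- Term n ≥ 0 :  (-1)^{tri n} q^{r·tri n + s·tri(n-1)}   (tri(n-1) = n(n-1)/2)
-- Term n = -m, m ≥ 1 : n(n+1)/2 = tri(m-1), n(n-1)/2 = tri m, so the term is
--   (-1)^{tri(m-1)} q^{r·tri(m-1) + s·tri m}, subtracted.
-- For r,s ≥ 1 every exponent of the n-th (resp. m-th) term is ≥ n (resp. ≥ m),
-- so only indices ≤ N can contribute to q^N.
posExp : ℕ → ℕ → ℕ → ℕ
posExp r s n = r ℕ.* tri n ℕ.+ s ℕ.* tri (n ℕ.∸ 1)

negExp : ℕ → ℕ → ℕ → ℕ
negExp r s m = r ℕ.* tri (m ℕ.∸ 1) ℕ.+ s ℕ.* tri m

psiCoeff : ℕ → ℕ → ℕ → ℤ
psiCoeff r s N =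
  sumℤ (map (λ n → if posExp r s n ≡ᵇ N then sgn (tri n) else + 0) (upTo (suc N)))
  ℤ.- sumℤ (map (λ i → if negExp r s (suc i) ≡ᵇ N then sgn (tri i) else + 0) (upTo N))

-- cs r s N = [c(N), c(N-1), ..., c(0)] where Σ c(n) q^n = 1 / Psi(-q^r, q^s).
-- Since the constant term of Psi(-q^r,q^s) is 1 (for r,s ≥ 1):
--   c(0) = 1,  c(N) = - Σ_{j=1}^{N} psiCoeff(j) · c(N-j).
cs : ℕ → ℕ → (N : ℕ) → Vec ℤ (suc N)
cs r s zero = + 1 ∷ []
cs r s (suc N) =
  (- sumℤ (zipWith ℤ._*_ (map (λ i → psiCoeff r s (suc i)) (upTo (suc N))) (toList (cs r s N))))
  ∷ cs r s N

c : ℕ → ℕ → ℕ → ℤ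
c r s N = head (cs r s N)

-- Modulo 2, Ψ(−q¹³, q) is the theta series θ(q) = Σ q^((x²−9)/7) over x ≡ ±3 (mod 7), and squaring is
-- the Frobenius map, so (Σ c(n) qⁿ) θ(q⁸) = θ(q⁸)/θ(q) = θ(q) θ(q²) θ(q⁴). Keeping the exponents 8μ + 7
-- expresses (Σ c(8μ+7) q^μ) θ(q) through the representations of 56μ + 112 by x² + 2y² + 4z² with
-- x, y, z ≡ ±3. There x and y are even, and the halving bijection (x, z) ↦ ((x+z)/2, |x−z|/2) between
-- the solutions of x² + z² + 2m = 2K and of u² + w² + m = K, which moves the classes
-- (±1, ±2) → (±2, ±3) → (±3, ±1) → (±1, ±2), turns this into θ(q) Σ R(7μ+5) q^μ, where R(T) is the
-- parity of the number of u ≡ ±1, w ≡ ±2 with u² + w² = T. Cancelling θ, c(8μ+7) ≡ R(7μ+5) (mod 2).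
-- Three halvings give R(8T) = R(T), and R(2ʲ(4t+3)) = 0 since no sum of two squares is 3 mod 4; in
-- each progression of the theorem, 7μ + 5 has this form.

module Submission where

open import Defs
open import Algebra.Bundles using (CommutativeMonoid; CommutativeRing)
import Algebra.Properties.CommutativeSemigroup as CommSemigroupProperties
import Algebra.Properties.Group as GroupProperties
import Algebra.Solver.CommutativeMonoid as CommutativeMonoidSolver
open import Data.Bool using (Bool; true; false; not; _∧_; _∨_; _xor_; if_then_else_; T)
open import Data.Bool.Properties
  using ( ∧-comm; ∧-assoc; ∧-idem; ∧-zeroʳ; ∧-identityʳ; ∧-conicalˡ; ∧-conicalʳ; ∧-inverseʳ; ¬-not
        ; ∧-distribˡ-xor; xor-assoc; xor-comm; xor-identityʳ; xor-same; xor-annihilates-not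
        ; not-involutive; not-distribˡ-xor
        ; ∧-commutativeMonoid; xor-∧-commutativeRing)
  renaming (_≟_ to _≟ᵇ_)
open import Data.Integer as ℤ using (ℤ; +_; -[1+_]; _⊖_)
open import Data.Integer.Divisibility using (_∣_)
open import Data.Integer.Properties using (∣-i∣≡∣i∣; abs-*; ∣⊖∣-≤; ∣m⊖n∣≡∣n⊖m∣)
open import Data.List using (_∷_; map; upTo; applyUpTo; zipWith)
open import Data.List.Properties using (map-applyUpTo)
open import Data.Nat
  using ( ℕ; zero; suc; _+_; _*_; _∸_; _^_; _≤_; _<_; _≟_; _≤?_; _<?_; _≡ᵇ_; _<ᵇ_; ∣_-_∣
        ; s≤s; s≤s⁻¹; z≤n; NonZero; >-nonZero; allUpTo?)
open import Data.Nat.DivMod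
  using ( _%_; _/_; m≡m%n+[m/n]*n; [m+kn]%n≡m%n; m*n/n≡m; m*[n/m]≡n; m%n%n≡m%n
        ; %-distribˡ-+; %-distribˡ-*; m%n<n)
open import Data.Nat.Divisibility using (divides; ∣m∣n⇒∣m+n; ∣-refl; _∣0) renaming (_∣_ to _∣ℕ_)
open import Data.Nat.Induction using (<-rec)
open import Data.Nat.Properties
open import Data.Nat.Tactic.RingSolver using (solve-∀)
open import Data.Product using (_×_; _,_; proj₁; proj₂; uncurry; ∃)
open import Data.Sum using (_⊎_; inj₁; inj₂)
open import Data.Vec using (toList)
open import Function using (_∘_; id)
open import Level using (0ℓ)
open import Relation.Binary.Bundles using (Setoid)
open import Relation.Binary.PropositionalEquality
open import Relation.Nullary using (Dec; yes; no; _×-dec_; _→-dec_)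
open import Relation.Nullary.Decidable using (True; toWitness; dec-true; dec-false; ¬?)

open CommSemigroupProperties (CommutativeRing.+-commutativeSemigroup xor-∧-commutativeRing)
  using () renaming (interchange to xor-interchange)
open CommSemigroupProperties (CommutativeMonoid.commutativeSemigroup ∧-commutativeMonoid)
  using (x∙yz≈y∙xz; x∙yz≈y∙zx)
open GroupProperties (CommutativeRing.+-group xor-∧-commutativeRing)
  using () renaming (∙-cancelˡ to xor-cancelˡ)


≡ᵇ-true⇒≡ : ∀ {m n} → (m ≡ᵇ n) ≡ true → m ≡ n
≡ᵇ-true⇒≡ {m} {n} eq = ≡ᵇ⇒≡ m n (subst T (sym eq) _)

≡ᵇ-sym : ∀ m n → (m ≡ᵇ n) ≡ (n ≡ᵇ m)
≡ᵇ-sym m n with m ≟ n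
... | yes refl = refl
... | no  m≢n  = trans (dec-false (m ≟ n) m≢n) (sym (dec-false (n ≟ m) (m≢n ∘ sym)))

≡ᵇ-injective : ∀ (f : ℕ → ℕ) → (∀ {m n} → f m ≡ f n → m ≡ n) →
               ∀ m n → (f m ≡ᵇ f n) ≡ (m ≡ᵇ n)
≡ᵇ-injective f f-inj m n with m ≟ n
... | yes refl = trans (dec-true (f m ≟ f m) refl) (sym (dec-true (m ≟ m) refl))
... | no  m≢n  = trans (dec-false (f m ≟ f n) (m≢n ∘ f-inj)) (sym (dec-false (m ≟ n) m≢n))

+-≡ᵇ-split : ∀ a b n → (a + b ≡ᵇ n) ≡ (a <ᵇ suc n) ∧ (b ≡ᵇ n ∸ a)
+-≡ᵇ-split a b n with a <? suc n
... | no a≮1+n rewrite dec-false (a <? suc n) a≮1+n =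
  dec-false (a + b ≟ n) λ { refl → a≮1+n (s≤s (m≤m+n a b)) }
... | yes a<1+n rewrite dec-true (a <? suc n) a<1+n with b ≟ n ∸ a
...   | yes refl  = trans (dec-true (a + (n ∸ a) ≟ n) (m+[n∸m]≡n (s≤s⁻¹ a<1+n)))
                          (sym (dec-true (n ∸ a ≟ n ∸ a) refl))
...   | no  b≢n∸a = trans (dec-false (a + b ≟ n) λ { refl → b≢n∸a (sym (m+n∸m≡n a b)) })
                          (sym (dec-false (b ≟ n ∸ a) b≢n∸a))

≡ᵇ-shift-affine : ∀ k a r e m s .{{_ : NonZero k}} → r < k →
                  (e <ᵇ suc m) ∧ (s ≡ᵇ k * (m ∸ e) + r) ≡ (k * e + a + s ≡ᵇ k * m + (a + r))
≡ᵇ-shift-affine k a r e m s r<k with e <? suc m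
... | yes e<1+m rewrite dec-true (e <? suc m) e<1+m = sym (begin
  k * e + a + s ≡ᵇ k * m + (a + r)
    ≡⟨ cong (λ t → k * e + a + s ≡ᵇ t) (split (m∸n+n≡m (s≤s⁻¹ e<1+m))) ⟩
  k * e + a + s ≡ᵇ k * e + a + (k * (m ∸ e) + r)
    ≡⟨ ≡ᵇ-injective (_+_ (k * e + a)) (+-cancelˡ-≡ (k * e + a) _ _) s _ ⟩
  s ≡ᵇ k * (m ∸ e) + r
    ∎)
  where
  open ≡-Reasoning
  split : m ∸ e + e ≡ m → k * m + (a + r) ≡ k * e + a + (k * (m ∸ e) + r)
  split eq = trans (cong (λ t → k * t + (a + r)) (sym eq)) (identity k (m ∸ e) e a r)
    where
    identity : ∀ k d e a r → k * (d + e) + (a + r) ≡ k * e + a + (k * d + r)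
    identity = solve-∀
... | no e≮1+m rewrite dec-false (e <? suc m) e≮1+m = sym (dec-false (_ ≟ _) (<⇒≢ too-big ∘ sym))
  where
  too-big : k * m + (a + r) < k * e + a + s
  too-big = begin-strict
    k * m + (a + r)    <⟨ +-monoʳ-< (k * m) (subst (a + r <_) (+-comm a k) (+-monoʳ-< a r<k)) ⟩
    k * m + (k + a)    ≡⟨ identity k m a ⟩
    k * suc m + a      ≤⟨ +-monoˡ-≤ a (*-monoʳ-≤ k (≰⇒> (e≮1+m ∘ s≤s))) ⟩
    k * e + a          ≤⟨ m≤m+n (k * e + a) s ⟩
    k * e + a + s      ∎
    where
    open ≤-Reasoning
    identity : ∀ k m a → k * m + (k + a) ≡ k * suc m + a
    identity = solve-∀

∧-implied : ∀ {b c} p → (c ≡ true → b ≡ true) → b ∧ (c ∧ p) ≡ c ∧ p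
∧-implied {b} {false} p _ = ∧-zeroʳ b
∧-implied {b} {true}  p c⇒b rewrite c⇒b refl = refl

∧-guard : ∀ {b b′} p → (p ≡ true → b ≡ b′) → b ∧ p ≡ b′ ∧ p
∧-guard {b} false _  = trans (∧-zeroʳ b) (sym (∧-zeroʳ _))
∧-guard       true  eq = cong (_∧ true) (eq refl)

∧₃-true : ∀ {x y z} → x ∧ (y ∧ z) ≡ true → x ≡ true × y ≡ true × z ≡ true
∧₃-true {true} {true} {true} _ = refl , refl , refl

∧-shuffle : ∀ b p i q → b ∧ (p ∧ (i ∧ q)) ≡ (b ∧ i) ∧ (p ∧ q)
∧-shuffle = solve 4 (λ b p i q → b ⊕ (p ⊕ (i ⊕ q)) ⊜ (b ⊕ i) ⊕ (p ⊕ q)) refl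
  where open CommutativeMonoidSolver ∧-commutativeMonoid using (solve; _⊕_; _⊜_)

xor-false⇒≡ : ∀ {a b} → a xor b ≡ false → a ≡ b
xor-false⇒≡ {false} {false} _ = refl
xor-false⇒≡ {true}  {true}  _ = refl

exact-div : ∀ {m} q d .{{_ : NonZero d}} → m ≡ q * d → m / d ≡ q
exact-div q d refl = m*n/n≡m q d

%-decompose : ∀ {a r} d .{{_ : NonZero d}} → a % d ≡ r → a ≡ d * (a / d) + r
%-decompose {a} d refl = trans (m≡m%n+[m/n]*n a d) (trans (+-comm (a % d) _) (cong (_+ a % d) (*-comm (a / d) d)))

halve : ∀ {m} n → m ≡ n + n → m / 2 ≡ n
halve n m≡n+n = exact-div n 2 (trans m≡n+n (trans (cong (_+_ n) (sym (+-identityʳ n))) (*-comm 2 n)))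

n≤n*n : ∀ n → n ≤ n * n
n≤n*n zero    = z≤n
n≤n*n (suc n) = m≤m*n (suc n) (suc n)

∣m+n-n∣≡m : ∀ m n → ∣ m + n - n ∣ ≡ m
∣m+n-n∣≡m m n = trans (∣-∣-comm (m + n) n) (trans (cong (∣ n -_∣) (+-comm m n)) (∣m-m+n∣≡n n m))


-- Sums modulo 2 over initial segments of ℕ

infixr 6 ⨁
⨁ : ℕ → (ℕ → Bool) → Bool
⨁ zero    f = false
⨁ (suc n) f = ⨁ n f xor f n

syntax ⨁ n (λ i → b) = ⨁[ i < n ] b

⨁-cong : ∀ n {f g : ℕ → Bool} → (∀ i → i < n → f i ≡ g i) → ⨁ n f ≡ ⨁ n g
⨁-cong zero    eq = refl
⨁-cong (suc n) eq = cong₂ _xor_ (⨁-cong n (λ i i<n → eq i (m<n⇒m<1+n i<n))) (eq n ≤-refl)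

⨁-false : ∀ n {f : ℕ → Bool} → (∀ i → i < n → f i ≡ false) → ⨁ n f ≡ false
⨁-false zero    eq = refl
⨁-false (suc n) eq =
  cong₂ _xor_ (⨁-false n (λ i i<n → eq i (m<n⇒m<1+n i<n))) (eq n ≤-refl)

⨁-xor : ∀ n (f g : ℕ → Bool) → ⨁[ i < n ] (f i xor g i) ≡ ⨁ n f xor ⨁ n g
⨁-xor zero    f g = refl
⨁-xor (suc n) f g =
  trans (cong (_xor (f n xor g n)) (⨁-xor n f g)) (xor-interchange (⨁ n f) (⨁ n g) (f n) (g n))

∧-distribˡ-⨁ : ∀ n b (f : ℕ → Bool) → b ∧ ⨁ n f ≡ ⨁[ i < n ] (b ∧ f i)
∧-distribˡ-⨁ zero    false f = refl
∧-distribˡ-⨁ zero    true  f = refl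
∧-distribˡ-⨁ (suc n) b     f =
  trans (∧-distribˡ-xor b (⨁ n f) (f n)) (cong (_xor (b ∧ f n)) (∧-distribˡ-⨁ n b f))

∧-distribˡ-⨁² : ∀ m n b (F : ℕ → ℕ → Bool) →
                b ∧ ⨁[ i < m ] ⨁[ j < n ] F i j ≡ ⨁[ i < m ] ⨁[ j < n ] (b ∧ F i j)
∧-distribˡ-⨁² m n b F = trans (∧-distribˡ-⨁ m b _) (⨁-cong m (λ i _ → ∧-distribˡ-⨁ n b (F i)))

∧∧-distrib-⨁ : ∀ n b c (f : ℕ → Bool) → b ∧ (c ∧ ⨁ n f) ≡ ⨁[ i < n ] (b ∧ (c ∧ f i))
∧∧-distrib-⨁ n b c f = trans (cong (b ∧_) (∧-distribˡ-⨁ n c f)) (∧-distribˡ-⨁ n b _)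

∧-distribʳ-⨁ : ∀ n b (f : ℕ → Bool) → ⨁ n f ∧ b ≡ ⨁[ i < n ] (f i ∧ b)
∧-distribʳ-⨁ n b f =
  trans (∧-comm (⨁ n f) b) (trans (∧-distribˡ-⨁ n b f) (⨁-cong n (λ i _ → ∧-comm b (f i))))

⨁-+ : ∀ m n (f : ℕ → Bool) → ⨁ (m + n) f ≡ ⨁ m f xor ⨁[ j < n ] f (m + j)
⨁-+ m zero    f = trans (cong (λ k → ⨁ k f) (+-identityʳ m)) (sym (xor-identityʳ (⨁ m f)))
⨁-+ m (suc n) f = begin
  ⨁ (m + suc n) f                                  ≡⟨ cong (λ k → ⨁ k f) (+-suc m n) ⟩
  ⨁ (m + n) f xor f (m + n)                        ≡⟨ cong (_xor f (m + n)) (⨁-+ m n f) ⟩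
  (⨁ m f xor ⨁[ j < n ] f (m + j)) xor f (m + n)   ≡⟨ xor-assoc (⨁ m f) _ (f (m + n)) ⟩
  ⨁ m f xor ⨁[ j < suc n ] f (m + j)               ∎
  where open ≡-Reasoning

⨁-suc : ∀ n (f : ℕ → Bool) → ⨁ (suc n) f ≡ f 0 xor ⨁[ i < n ] f (suc i)
⨁-suc = ⨁-+ 1

⨁-extend : ∀ {m n} (f : ℕ → Bool) → m ≤ n → (∀ i → m ≤ i → i < n → f i ≡ false) →
           ⨁ n f ≡ ⨁ m f
⨁-extend {m} {n} f m≤n vanish = begin
  ⨁ n f                                    ≡⟨ cong (λ k → ⨁ k f) (sym (m+[n∸m]≡n m≤n)) ⟩
  ⨁ (m + (n ∸ m)) f                        ≡⟨ ⨁-+ m (n ∸ m) f ⟩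
  ⨁ m f xor ⨁[ j < n ∸ m ] f (m + j)       ≡⟨ cong (⨁ m f xor_) (⨁-false (n ∸ m) tail-vanishes) ⟩
  ⨁ m f xor false                          ≡⟨ xor-identityʳ (⨁ m f) ⟩
  ⨁ m f                                    ∎
  where
  open ≡-Reasoning
  tail-vanishes : ∀ j → j < n ∸ m → f (m + j) ≡ false
  tail-vanishes j j<n∸m = vanish (m + j) (m≤m+n m j)
    (subst (m + j <_) (m+[n∸m]≡n m≤n) (+-monoʳ-< m j<n∸m))

⨁-single : ∀ n k (f : ℕ → Bool) → k < n → (∀ i → i < n → i ≢ k → f i ≡ false) → ⨁ n f ≡ f k
⨁-single (suc n) k f k<1+n vanish with k ≟ n
... | yes refl = cong (_xor f k) (⨁-false n (λ i i<n → vanish i (m<n⇒m<1+n i<n) (<⇒≢ i<n)))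
... | no  k≢n  = begin
  ⨁ n f xor f n  ≡⟨ cong₂ _xor_ (⨁-single n k f (≤∧≢⇒< (s≤s⁻¹ k<1+n) k≢n)
                                   (λ i i<n → vanish i (m<n⇒m<1+n i<n)))
                               (vanish n ≤-refl (k≢n ∘ sym)) ⟩
  f k xor false  ≡⟨ xor-identityʳ (f k) ⟩
  f k            ∎
  where open ≡-Reasoning

⨁-select : ∀ n k (h : ℕ → Bool) → ⨁[ i < n ] ((k ≡ᵇ i) ∧ h i) ≡ (k <ᵇ n) ∧ h k
⨁-select n k h with k <? n
... | yes k<n = begin
  ⨁[ i < n ] ((k ≡ᵇ i) ∧ h i)  ≡⟨ ⨁-single n k _ k<n (λ i _ i≢k →
                                    cong (_∧ h i) (dec-false (k ≟ i) (i≢k ∘ sym))) ⟩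
  (k ≡ᵇ k) ∧ h k               ≡⟨ cong (_∧ h k) (dec-true (k ≟ k) refl) ⟩
  h k                          ≡⟨ cong (_∧ h k) (dec-true (k <? n) k<n) ⟨
  (k <ᵇ n) ∧ h k               ∎
  where open ≡-Reasoning
... | no  k≮n = trans (⨁-false n (λ i i<n → cong (_∧ h i) (dec-false (k ≟ i) λ { refl → k≮n i<n })))
                      (cong (_∧ h k) (sym (dec-false (k <? n) k≮n)))

⨁-below : ∀ {m B} (h : ℕ → Bool) → m ≤ B → ⨁[ i < B ] ((i <ᵇ m) ∧ h i) ≡ ⨁ m h
⨁-below {m} {B} h m≤B = begin
  ⨁[ i < B ] ((i <ᵇ m) ∧ h i)  ≡⟨ ⨁-extend _ m≤B (λ i m≤i _ →
                                    cong (_∧ h i) (dec-false (i <? m) (≤⇒≯ m≤i))) ⟩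
  ⨁[ i < m ] ((i <ᵇ m) ∧ h i)  ≡⟨ ⨁-cong m (λ i i<m → cong (_∧ h i) (dec-true (i <? m) i<m)) ⟩
  ⨁ m h                        ∎
  where open ≡-Reasoning

⨁-shift-select : ∀ B a n (h : ℕ → Bool) → n < B →
                 ⨁[ j < B ] ((a + j ≡ᵇ n) ∧ h j) ≡ (a <ᵇ suc n) ∧ h (n ∸ a)
⨁-shift-select B a n h n<B = begin
  ⨁[ j < B ] ((a + j ≡ᵇ n) ∧ h j)
    ≡⟨ ⨁-cong B (λ j _ → trans (cong (_∧ h j) (trans (+-≡ᵇ-split a j n)
                                                      (cong ((a <ᵇ suc n) ∧_) (≡ᵇ-sym j (n ∸ a)))))
                               (∧-assoc (a <ᵇ suc n) _ (h j))) ⟩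
  ⨁[ j < B ] ((a <ᵇ suc n) ∧ ((n ∸ a ≡ᵇ j) ∧ h j))
    ≡⟨ ∧-distribˡ-⨁ B (a <ᵇ suc n) _ ⟨
  (a <ᵇ suc n) ∧ ⨁[ j < B ] ((n ∸ a ≡ᵇ j) ∧ h j)
    ≡⟨ cong ((a <ᵇ suc n) ∧_) (trans (⨁-select B (n ∸ a) h)
         (cong (_∧ h (n ∸ a)) (dec-true (n ∸ a <? B) (≤-<-trans (m∸n≤m n a) n<B)))) ⟩
  (a <ᵇ suc n) ∧ h (n ∸ a)
    ∎
  where open ≡-Reasoning

∧-⨁-shift : ∀ L a n p (G : ℕ → ℕ) (q : ℕ → Bool) →
            (a <ᵇ suc n) ∧ (p ∧ ⨁[ z < L ] ((G z ≡ᵇ n ∸ a) ∧ q z)) ≡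
            ⨁[ z < L ] ((a + G z ≡ᵇ n) ∧ (p ∧ q z))
∧-⨁-shift L a n p G q =
  trans (∧∧-distrib-⨁ L (a <ᵇ suc n) p (λ z → (G z ≡ᵇ n ∸ a) ∧ q z)) (⨁-cong L shift)
  where
  open ≡-Reasoning
  shift : ∀ z → z < L → (a <ᵇ suc n) ∧ (p ∧ ((G z ≡ᵇ n ∸ a) ∧ q z)) ≡ (a + G z ≡ᵇ n) ∧ (p ∧ q z)
  shift z _ = begin
    (a <ᵇ suc n) ∧ (p ∧ ((G z ≡ᵇ n ∸ a) ∧ q z))
      ≡⟨ ∧-shuffle (a <ᵇ suc n) p (G z ≡ᵇ n ∸ a) (q z) ⟩
    ((a <ᵇ suc n) ∧ (G z ≡ᵇ n ∸ a)) ∧ (p ∧ q z)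
      ≡⟨ cong (_∧ (p ∧ q z)) (+-≡ᵇ-split a (G z) n) ⟨
    (a + G z ≡ᵇ n) ∧ (p ∧ q z)
      ∎

⨁-comm : ∀ m n (f : ℕ → ℕ → Bool) →
         ⨁[ i < m ] ⨁[ j < n ] f i j ≡ ⨁[ j < n ] ⨁[ i < m ] f i j
⨁-comm zero    n f = sym (⨁-false n (λ _ _ → refl))
⨁-comm (suc m) n f = begin
  ⨁[ i < m ] ⨁[ j < n ] f i j xor ⨁[ j < n ] f m j   ≡⟨ cong (_xor ⨁[ j < n ] f m j) (⨁-comm m n f) ⟩
  ⨁[ j < n ] ⨁[ i < m ] f i j xor ⨁[ j < n ] f m j   ≡⟨ ⨁-xor n _ _ ⟨
  ⨁[ j < n ] ⨁[ i < suc m ] f i j                     ∎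
  where open ≡-Reasoning

⨁-sink₃ : ∀ a b c (F : ℕ → ℕ → ℕ → Bool) →
          ⨁[ i < a ] ⨁[ j < b ] ⨁[ k < c ] F i j k ≡ ⨁[ j < b ] ⨁[ k < c ] ⨁[ i < a ] F i j k
⨁-sink₃ a b c F = trans (⨁-comm a b _) (⨁-cong b (λ j _ → ⨁-comm a c _))

⨁-sink₄ : ∀ a b c d (F : ℕ → ℕ → ℕ → ℕ → Bool) →
          ⨁[ i < a ] ⨁[ j < b ] ⨁[ k < c ] ⨁[ l < d ] F i j k l ≡
          ⨁[ j < b ] ⨁[ k < c ] ⨁[ l < d ] ⨁[ i < a ] F i j k l
⨁-sink₄ a b c d F = trans (⨁-comm a b _) (⨁-cong b (λ j _ → ⨁-sink₃ a c d (λ i → F i j)))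

⨁-diagonal : ∀ n (f : ℕ → ℕ → Bool) → (∀ i j → f i j ≡ f j i) →
             ⨁[ i < n ] ⨁[ j < n ] f i j ≡ ⨁[ i < n ] f i i
⨁-diagonal zero    f sym-f = refl
⨁-diagonal (suc n) f sym-f = begin
  ⨁[ i < n ] (⨁[ j < n ] f i j xor f i n) xor (⨁[ j < n ] f n j xor f n n)
    ≡⟨ cong₂ (λ s t → s xor (t xor f n n)) (⨁-xor n _ _) (⨁-cong n (λ j _ → sym-f n j)) ⟩
  (⨁[ i < n ] ⨁[ j < n ] f i j xor ⨁[ i < n ] f i n) xor (⨁[ i < n ] f i n xor f n n)
    ≡⟨ cong (λ s → (s xor column) xor (column xor f n n)) (⨁-diagonal n f sym-f) ⟩
  (⨁[ i < n ] f i i xor ⨁[ i < n ] f i n) xor (⨁[ i < n ] f i n xor f n n)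
    ≡⟨ cancel-middle (⨁[ i < n ] f i i) (⨁[ i < n ] f i n) (f n n) ⟩
  ⨁[ i < n ] f i i xor f n n
    ∎
  where
  open ≡-Reasoning
  column = ⨁[ i < n ] f i n
  cancel-middle : ∀ a b c → (a xor b) xor (b xor c) ≡ a xor c
  cancel-middle a b c = begin
    (a xor b) xor (b xor c)  ≡⟨ xor-assoc a b (b xor c) ⟩
    a xor (b xor (b xor c))  ≡⟨ cong (a xor_) (xor-assoc b b c) ⟨
    a xor ((b xor b) xor c)  ≡⟨ cong (λ s → a xor (s xor c)) (xor-same b) ⟩
    a xor c                  ∎

⨁-blocks : ∀ n b (f : ℕ → Bool) → ⨁ (n * b) f ≡ ⨁[ q < n ] ⨁[ r < b ] f (q * b + r)
⨁-blocks zero    b f = refl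
⨁-blocks (suc n) b f = begin
  ⨁ (b + n * b) f
    ≡⟨ ⨁-+ b (n * b) f ⟩
  ⨁ b f xor ⨁[ j < n * b ] f (b + j)
    ≡⟨ cong (⨁ b f xor_) (⨁-blocks n b _) ⟩
  ⨁ b f xor ⨁[ q < n ] ⨁[ r < b ] f (b + (q * b + r))
    ≡⟨ cong (⨁ b f xor_) (⨁-cong n λ q _ → ⨁-cong b λ r _ → cong f (sym (+-assoc b (q * b) r))) ⟩
  ⨁ b f xor ⨁[ q < n ] ⨁[ r < b ] f (suc q * b + r)
    ≡⟨ ⨁-suc n _ ⟨
  ⨁[ q < suc n ] ⨁[ r < b ] f (q * b + r)
    ∎
  where open ≡-Reasoning

⨁-even : ∀ n (f : ℕ → Bool) → (∀ q → f (q * 2 + 1) ≡ false) → ⨁ (n * 2) f ≡ ⨁[ q < n ] f (q * 2)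
⨁-even n f odd-vanish = trans (⨁-blocks n 2 f) (⨁-cong n λ q _ →
  trans (cong₂ _xor_ (cong f (+-identityʳ (q * 2))) (odd-vanish q)) (xor-identityʳ (f (q * 2))))

infix 4 _≡ᵖ_
_≡ᵖ_ : ℕ × ℕ → ℕ × ℕ → Bool
(a , b) ≡ᵖ (u , w) = (a ≡ᵇ u) ∧ (b ≡ᵇ w)

≡ᵖ-refl : ∀ p → (p ≡ᵖ p) ≡ true
≡ᵖ-refl (a , b) = cong₂ _∧_ (dec-true (a ≟ a) refl) (dec-true (b ≟ b) refl)

≡ᵖ-true⇒≡ : ∀ {p q} → (p ≡ᵖ q) ≡ true → p ≡ q
≡ᵖ-true⇒≡ {a , b} {u , w} eq =
  cong₂ _,_ (≡ᵇ-true⇒≡ (∧-conicalˡ _ _ eq)) (≡ᵇ-true⇒≡ (∧-conicalʳ _ _ eq))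

⨁²-single : ∀ n a b (F : ℕ → ℕ → Bool) → a < n → b < n →
            (∀ u w → F u w ≡ true → (u , w) ≡ (a , b)) → ⨁[ u < n ] ⨁[ w < n ] F u w ≡ F a b
⨁²-single n a b F a<n b<n only-ab =
  trans (⨁-single n a _ a<n (λ u _ u≢a → ⨁-false n (λ w _ →
           ¬-not λ Fuw → u≢a (cong proj₁ (only-ab u w Fuw)))))
        (⨁-single n b _ b<n (λ w _ w≢b →
           ¬-not λ Faw → w≢b (cong proj₂ (only-ab a w Faw))))

record BoxBijection (m n : ℕ) (P Q : ℕ → ℕ → Bool) : Set where
  field
    to from   : ℕ → ℕ → ℕ × ℕ
    to-box    : ∀ {x y} → P x y ≡ true → proj₁ (to x y) < n × proj₂ (to x y) < n
    from-box  : ∀ {u w} → Q u w ≡ true → proj₁ (from u w) < m × proj₂ (from u w) < m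
    to-sat    : ∀ {x y} → P x y ≡ true → uncurry Q (to x y) ≡ true
    from-sat  : ∀ {u w} → Q u w ≡ true → uncurry P (from u w) ≡ true
    from-to   : ∀ {x y} → P x y ≡ true → uncurry from (to x y) ≡ (x , y)
    to-from   : ∀ {u w} → Q u w ≡ true → uncurry to (from u w) ≡ (u , w)

⨁²-bijection : ∀ {m n P Q} → BoxBijection m n P Q →
               ⨁[ x < m ] ⨁[ y < m ] P x y ≡ ⨁[ u < n ] ⨁[ w < n ] Q u w
⨁²-bijection {m} {n} {P} {Q} bij = begin
  ⨁[ x < m ] ⨁[ y < m ] P x y
    ≡⟨ ⨁-cong m (λ x _ → ⨁-cong m (λ y _ → count-images x y)) ⟨
  ⨁[ x < m ] ⨁[ y < m ] ⨁[ u < n ] ⨁[ w < n ] D x y u w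
    ≡⟨ ⨁-sink₄ m m n n D ⟩
  ⨁[ y < m ] ⨁[ u < n ] ⨁[ w < n ] ⨁[ x < m ] D x y u w
    ≡⟨ ⨁-sink₄ m n n m (λ y u w x → D x y u w) ⟩
  ⨁[ u < n ] ⨁[ w < n ] ⨁[ x < m ] ⨁[ y < m ] D x y u w
    ≡⟨ ⨁-cong n (λ u _ → ⨁-cong n (λ w _ → count-preimages u w)) ⟩
  ⨁[ u < n ] ⨁[ w < n ] Q u w
    ∎
  where
  open ≡-Reasoning
  open BoxBijection bij
  D : ℕ → ℕ → ℕ → ℕ → Bool
  D x y u w = P x y ∧ (to x y ≡ᵖ (u , w))
  D-true : ∀ {x y u w} → D x y u w ≡ true → P x y ≡ true × to x y ≡ (u , w)
  D-true {x} {y} {u} {w} eq = ∧-conicalˡ (P x y) _ eq , ≡ᵖ-true⇒≡ (∧-conicalʳ (P x y) _ eq)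
  count-images : ∀ x y → ⨁[ u < n ] ⨁[ w < n ] D x y u w ≡ P x y
  count-images x y with P x y in Pxy
  ... | false = ⨁-false n (λ u _ → ⨁-false n (λ w _ → refl))
  ... | true  = trans (⨁²-single n _ _ (λ u w → to x y ≡ᵖ (u , w)) (proj₁ (to-box Pxy)) (proj₂ (to-box Pxy))
                             (λ u w eq → sym (≡ᵖ-true⇒≡ eq)))
                      (≡ᵖ-refl (to x y))
  count-preimages : ∀ u w → ⨁[ x < m ] ⨁[ y < m ] D x y u w ≡ Q u w
  count-preimages u w with Q u w in Quw
  ... | false = ⨁-false m (λ x _ → ⨁-false m (λ y _ → ¬-not λ D≡ →
                  let (Pxy , to≡) = D-true D≡ in
                  true≢false (trans (sym (subst (λ v → uncurry Q v ≡ true) to≡ (to-sat Pxy))) Quw)))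
    where
    true≢false : true ≢ false
    true≢false ()
  ... | true  = begin
    ⨁[ x < m ] ⨁[ y < m ] D x y u w
      ≡⟨ ⨁²-single m _ _ (λ x y → D x y u w) (proj₁ (from-box Quw)) (proj₂ (from-box Quw)) preimage-unique ⟩
    uncurry P (from u w) ∧ (uncurry to (from u w) ≡ᵖ (u , w))
      ≡⟨ cong₂ _∧_ (from-sat Quw) (trans (cong (_≡ᵖ (u , w)) (to-from Quw)) (≡ᵖ-refl (u , w))) ⟩
    true
      ∎
    where
    preimage-unique : ∀ x y → D x y u w ≡ true → (x , y) ≡ from u w
    preimage-unique x y D≡ = let (Pxy , to≡) = D-true D≡ in trans (sym (from-to Pxy)) (cong (uncurry from) to≡)


-- Power series over GF(2)

Series : Set
Series = ℕ → Bool

infixl 7 _⊛_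
_⊛_ : Series → Series → Series
(f ⊛ g) n = ⨁[ i < suc n ] (f i ∧ g (n ∸ i))

𝟙 : Series
𝟙 zero    = true
𝟙 (suc _) = false

dilate : ℕ → Series → Series
dilate k f n = ⨁[ j < suc n ] ((k * j ≡ᵇ n) ∧ f j)

⊛-cong : ∀ {f f′ g g′} → f ≗ f′ → g ≗ g′ → f ⊛ g ≗ f′ ⊛ g′
⊛-cong f≗f′ g≗g′ n = ⨁-cong (suc n) (λ i _ → cong₂ _∧_ (f≗f′ i) (g≗g′ (n ∸ i)))

⊛-congˡ : ∀ f {g g′} → g ≗ g′ → f ⊛ g ≗ f ⊛ g′
⊛-congˡ f g≗g′ n = ⨁-cong (suc n) (λ i _ → cong (f i ∧_) (g≗g′ (n ∸ i)))

⊛-congʳ : ∀ {f f′} g → f ≗ f′ → f ⊛ g ≗ f′ ⊛ g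
⊛-congʳ g f≗f′ n = ⨁-cong (suc n) (λ i _ → cong (_∧ g (n ∸ i)) (f≗f′ i))

⊛-identityˡ : ∀ f → 𝟙 ⊛ f ≗ f
⊛-identityˡ f n = begin
  ⨁[ i < suc n ] (𝟙 i ∧ f (n ∸ i))  ≡⟨ ⨁-suc n _ ⟩
  f n xor ⨁[ i < n ] false          ≡⟨ cong (f n xor_) (⨁-false n (λ _ _ → refl)) ⟩
  f n xor false                     ≡⟨ xor-identityʳ (f n) ⟩
  f n                               ∎
  where open ≡-Reasoning

⊛-double-sum : ∀ {B} f g n → n < B → (f ⊛ g) n ≡ ⨁[ i < B ] ⨁[ j < B ] ((i + j ≡ᵇ n) ∧ (f i ∧ g j))
⊛-double-sum {B} f g n n<B = sym (begin
  ⨁[ i < B ] ⨁[ j < B ] ((i + j ≡ᵇ n) ∧ (f i ∧ g j))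
    ≡⟨ ⨁-cong B (λ i _ → ⨁-shift-select B i n (λ j → f i ∧ g j) n<B) ⟩
  ⨁[ i < B ] ((i <ᵇ suc n) ∧ (f i ∧ g (n ∸ i)))
    ≡⟨ ⨁-below (λ i → f i ∧ g (n ∸ i)) n<B ⟩
  (f ⊛ g) n
    ∎)
  where open ≡-Reasoning

⊛-comm : ∀ f g → f ⊛ g ≗ g ⊛ f
⊛-comm f g n = begin
  (f ⊛ g) n
    ≡⟨ ⊛-double-sum f g n ≤-refl ⟩
  ⨁[ i < suc n ] ⨁[ j < suc n ] ((i + j ≡ᵇ n) ∧ (f i ∧ g j))
    ≡⟨ ⨁-comm (suc n) (suc n) _ ⟩
  ⨁[ j < suc n ] ⨁[ i < suc n ] ((i + j ≡ᵇ n) ∧ (f i ∧ g j))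
    ≡⟨ ⨁-cong (suc n) (λ j _ → ⨁-cong (suc n) (λ i _ →
         cong₂ _∧_ (cong (_≡ᵇ n) (+-comm i j)) (∧-comm (f i) (g j)))) ⟩
  ⨁[ j < suc n ] ⨁[ i < suc n ] ((j + i ≡ᵇ n) ∧ (g j ∧ f i))
    ≡⟨ ⊛-double-sum g f n ≤-refl ⟨
  (g ⊛ f) n
    ∎
  where open ≡-Reasoning

triple : Series → Series → Series → Series
triple f g h n = ⨁[ i < suc n ] ⨁[ j < suc n ] ⨁[ k < suc n ] ((i + j + k ≡ᵇ n) ∧ (f i ∧ (g j ∧ h k)))

⊛-triple : ∀ f g h → (f ⊛ g) ⊛ h ≗ triple f g h
⊛-triple f g h n = begin
  ((f ⊛ g) ⊛ h) n
    ≡⟨ ⊛-double-sum (f ⊛ g) h n ≤-refl ⟩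
  ⨁[ s < B ] ⨁[ k < B ] ((s + k ≡ᵇ n) ∧ ((f ⊛ g) s ∧ h k))
    ≡⟨ ⨁-cong B (λ s s<B → ⨁-cong B (λ k _ → expand s k s<B)) ⟩
  ⨁[ s < B ] ⨁[ k < B ] ⨁[ i < B ] ⨁[ j < B ] term s k i j
    ≡⟨ ⨁-sink₄ B B B B term ⟩
  ⨁[ k < B ] ⨁[ i < B ] ⨁[ j < B ] ⨁[ s < B ] term s k i j
    ≡⟨ ⨁-sink₃ B B B (λ k i j → ⨁[ s < B ] term s k i j) ⟩
  ⨁[ i < B ] ⨁[ j < B ] ⨁[ k < B ] ⨁[ s < B ] term s k i j
    ≡⟨ ⨁-cong B (λ i _ → ⨁-cong B (λ j _ → ⨁-cong B (λ k _ → select-s i j k))) ⟩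
  triple f g h n
    ∎
  where
  open ≡-Reasoning
  open CommutativeMonoidSolver ∧-commutativeMonoid using (solve; _⊕_; _⊜_)
  B = suc n
  term : ℕ → ℕ → ℕ → ℕ → Bool
  term s k i j = (i + j ≡ᵇ s) ∧ ((s + k ≡ᵇ n) ∧ (f i ∧ (g j ∧ h k)))
  expand : ∀ s k → s < B → (s + k ≡ᵇ n) ∧ ((f ⊛ g) s ∧ h k) ≡ ⨁[ i < B ] ⨁[ j < B ] term s k i j
  expand s k s<B = begin
    (s + k ≡ᵇ n) ∧ ((f ⊛ g) s ∧ h k)
      ≡⟨ cong (λ t → (s + k ≡ᵇ n) ∧ (t ∧ h k)) (⊛-double-sum f g s s<B) ⟩
    (s + k ≡ᵇ n) ∧ ((⨁[ i < B ] ⨁[ j < B ] ((i + j ≡ᵇ s) ∧ (f i ∧ g j))) ∧ h k)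
      ≡⟨ cong ((s + k ≡ᵇ n) ∧_) (∧-distribʳ-⨁ B (h k) _) ⟩
    (s + k ≡ᵇ n) ∧ ⨁[ i < B ] ((⨁[ j < B ] ((i + j ≡ᵇ s) ∧ (f i ∧ g j))) ∧ h k)
      ≡⟨ ∧-distribˡ-⨁ B (s + k ≡ᵇ n) _ ⟩
    ⨁[ i < B ] ((s + k ≡ᵇ n) ∧ ((⨁[ j < B ] ((i + j ≡ᵇ s) ∧ (f i ∧ g j))) ∧ h k))
      ≡⟨ ⨁-cong B (λ i _ → trans (cong ((s + k ≡ᵇ n) ∧_) (∧-distribʳ-⨁ B (h k) _))
                                 (∧-distribˡ-⨁ B (s + k ≡ᵇ n) _)) ⟩
    ⨁[ i < B ] ⨁[ j < B ] ((s + k ≡ᵇ n) ∧ (((i + j ≡ᵇ s) ∧ (f i ∧ g j)) ∧ h k))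
      ≡⟨ ⨁-cong B (λ i _ → ⨁-cong B (λ j _ →
           solve 5 (λ e e′ x y z → e ⊕ ((e′ ⊕ (x ⊕ y)) ⊕ z) ⊜ e′ ⊕ (e ⊕ (x ⊕ (y ⊕ z)))) refl
                   (s + k ≡ᵇ n) (i + j ≡ᵇ s) (f i) (g j) (h k))) ⟩
    ⨁[ i < B ] ⨁[ j < B ] term s k i j
      ∎
  select-s : ∀ i j k → ⨁[ s < B ] term s k i j ≡ (i + j + k ≡ᵇ n) ∧ (f i ∧ (g j ∧ h k))
  select-s i j k = trans (⨁-select B (i + j) _) (∧-implied _ (λ i+j+k≡n →
    dec-true (i + j <? B) (s≤s (subst (i + j ≤_) (≡ᵇ-true⇒≡ i+j+k≡n) (m≤m+n (i + j) k)))))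

triple-rotate : ∀ f g h → triple f g h ≗ triple g h f
triple-rotate f g h n =
  trans (⨁-sink₃ (suc n) (suc n) (suc n) _) (⨁-cong (suc n) λ j _ → ⨁-cong (suc n) λ k _ → ⨁-cong (suc n) λ i _ →
    cong₂ _∧_ (cong (_≡ᵇ n) (trans (+-assoc i j k) (+-comm i (j + k)))) (x∙yz≈y∙zx (f i) (g j) (h k)))

⊛-assoc : ∀ f g h → (f ⊛ g) ⊛ h ≗ f ⊛ (g ⊛ h)
⊛-assoc f g h n = begin
  ((f ⊛ g) ⊛ h) n  ≡⟨ ⊛-triple f g h n ⟩
  triple f g h n   ≡⟨ triple-rotate f g h n ⟩
  triple g h f n   ≡⟨ ⊛-triple g h f n ⟨
  ((g ⊛ h) ⊛ f) n  ≡⟨ ⊛-comm (g ⊛ h) f n ⟩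
  (f ⊛ (g ⊛ h)) n  ∎
  where open ≡-Reasoning

⊛-commutativeMonoid : CommutativeMonoid 0ℓ 0ℓ
⊛-commutativeMonoid = record
  { isCommutativeMonoid = record
    { isMonoid = record
      { isSemigroup = record
        { isMagma = record { isEquivalence = Setoid.isEquivalence (ℕ →-setoid Bool) ; ∙-cong = ⊛-cong }
        ; assoc = ⊛-assoc
        }
      ; identity = ⊛-identityˡ , λ f n → trans (⊛-comm f 𝟙 n) (⊛-identityˡ f n)
      }
    ; comm = ⊛-comm
    }
  }

⊛-cancelʳ : ∀ {f g F} → F 0 ≡ true → f ⊛ F ≗ g ⊛ F → f ≗ g
⊛-cancelʳ {f} {g} {F} F0 eq = <-rec (λ n → f n ≡ g n) step
  where
  leading : ∀ h n → h n ∧ F (n ∸ n) ≡ h n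
  leading h n = trans (cong (h n ∧_) (trans (cong F (n∸n≡0 n)) F0)) (∧-identityʳ (h n))
  step : ∀ n → (∀ {i} → i < n → f i ≡ g i) → f n ≡ g n
  step n f≡g-below = begin
    f n               ≡⟨ leading f n ⟨
    f n ∧ F (n ∸ n)   ≡⟨ xor-cancelˡ (⨁[ i < n ] (g i ∧ F (n ∸ i))) _ _ (begin
      ⨁[ i < n ] (g i ∧ F (n ∸ i)) xor (f n ∧ F (n ∸ n))
        ≡⟨ cong (_xor _) (⨁-cong n (λ i i<n → cong (_∧ F (n ∸ i)) (f≡g-below i<n))) ⟨
      (f ⊛ F) n  ≡⟨ eq n ⟩
      (g ⊛ F) n  ∎) ⟩
    g n ∧ F (n ∸ n)   ≡⟨ leading g n ⟩
    g n               ∎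
    where open ≡-Reasoning

frobenius : ∀ f → f ⊛ f ≗ dilate 2 f
frobenius f n = begin
  (f ⊛ f) n
    ≡⟨ ⊛-double-sum f f n ≤-refl ⟩
  ⨁[ i < suc n ] ⨁[ j < suc n ] ((i + j ≡ᵇ n) ∧ (f i ∧ f j))
    ≡⟨ ⨁-diagonal (suc n) _ (λ i j → cong₂ _∧_ (cong (_≡ᵇ n) (+-comm i j)) (∧-comm (f i) (f j))) ⟩
  ⨁[ i < suc n ] ((i + i ≡ᵇ n) ∧ (f i ∧ f i))
    ≡⟨ ⨁-cong (suc n) (λ i _ →
         cong₂ _∧_ (cong (λ m → i + m ≡ᵇ n) (sym (+-identityʳ i))) (∧-idem (f i))) ⟩
  dilate 2 f n
    ∎
  where open ≡-Reasoning

-- Up to degree n, f is the generating series of the exponents e x of the x < L with p x.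
record Family (L : ℕ) (e : ℕ → ℕ) (p : ℕ → Bool) (n : ℕ) (f : Series) : Set where
  constructor family
  field coeff : ∀ i → i ≤ n → f i ≡ ⨁[ x < L ] ((e x ≡ᵇ i) ∧ p x)
open Family

⊛-family : ∀ {L e p n f} g → Family L e p n f →
           (f ⊛ g) n ≡ ⨁[ x < L ] ((e x <ᵇ suc n) ∧ (p x ∧ g (n ∸ e x)))
⊛-family {L} {e} {p} {n} {f} g (family fam) = begin
  ⨁[ i < suc n ] (f i ∧ g (n ∸ i))
    ≡⟨ ⨁-cong (suc n) (λ i i≤n →
         trans (cong (_∧ g (n ∸ i)) (fam i (s≤s⁻¹ i≤n))) (∧-distribʳ-⨁ L _ _)) ⟩
  ⨁[ i < suc n ] ⨁[ x < L ] (((e x ≡ᵇ i) ∧ p x) ∧ g (n ∸ i))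
    ≡⟨ ⨁-comm (suc n) L _ ⟩
  ⨁[ x < L ] ⨁[ i < suc n ] (((e x ≡ᵇ i) ∧ p x) ∧ g (n ∸ i))
    ≡⟨ ⨁-cong L (λ x _ → trans (⨁-cong (suc n) (λ i _ → ∧-assoc (e x ≡ᵇ i) (p x) _))
                               (⨁-select (suc n) (e x) (λ i → p x ∧ g (n ∸ i)))) ⟩
  ⨁[ x < L ] ((e x <ᵇ suc n) ∧ (p x ∧ g (n ∸ e x)))
    ∎
  where open ≡-Reasoning

family-self : ∀ {L n} f → n < L → Family L (λ x → x) f n f
family-self {L} f n<L = family λ i i≤n → sym (begin
  ⨁[ x < L ] ((x ≡ᵇ i) ∧ f x)  ≡⟨ ⨁-cong L (λ x _ → cong (_∧ f x) (≡ᵇ-sym x i)) ⟩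
  ⨁[ x < L ] ((i ≡ᵇ x) ∧ f x)  ≡⟨ ⨁-select L i f ⟩
  (i <ᵇ L) ∧ f i               ≡⟨ cong (_∧ f i) (dec-true (i <? L) (≤-<-trans i≤n n<L)) ⟩
  f i                          ∎)
  where open ≡-Reasoning

dilate-family : ∀ {L e p n f} k .{{_ : NonZero k}} → Family L e p n f →
                Family L (λ x → k * e x) p n (dilate k f)
dilate-family {L} {e} {p} {n} {f} k (family fam) = family λ i i≤n → begin
  ⨁[ j < suc i ] ((k * j ≡ᵇ i) ∧ f j)
    ≡⟨ ⨁-cong (suc i) (λ j j≤i → trans (cong ((k * j ≡ᵇ i) ∧_) (fam j (≤-trans (s≤s⁻¹ j≤i) i≤n)))
                                       (∧-distribˡ-⨁ L _ _)) ⟩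
  ⨁[ j < suc i ] ⨁[ x < L ] ((k * j ≡ᵇ i) ∧ ((e x ≡ᵇ j) ∧ p x))
    ≡⟨ ⨁-comm (suc i) L _ ⟩
  ⨁[ x < L ] ⨁[ j < suc i ] ((k * j ≡ᵇ i) ∧ ((e x ≡ᵇ j) ∧ p x))
    ≡⟨ ⨁-cong L (λ x _ → trans (⨁-cong (suc i) (λ j _ → x∙yz≈y∙xz (k * j ≡ᵇ i) (e x ≡ᵇ j) (p x)))
                               (⨁-select (suc i) (e x) (λ j → (k * j ≡ᵇ i) ∧ p x))) ⟩
  ⨁[ x < L ] ((e x <ᵇ suc i) ∧ ((k * e x ≡ᵇ i) ∧ p x))
    ≡⟨ ⨁-cong L (λ x _ → ∧-implied (p x) (λ kex≡i →
         dec-true (e x <? suc i) (s≤s (subst (e x ≤_) (≡ᵇ-true⇒≡ kex≡i) (m≤n*m (e x) k))))) ⟩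
  ⨁[ x < L ] ((k * e x ≡ᵇ i) ∧ p x)
    ∎
  where open ≡-Reasoning

dilate-dilate : ∀ a b .{{_ : NonZero a}} .{{_ : NonZero b}} f → dilate a (dilate b f) ≗ dilate (a * b) f
dilate-dilate a b f n = begin
  dilate a (dilate b f) n
    ≡⟨ coeff (dilate-family a (dilate-family b (family-self f ≤-refl))) n ≤-refl ⟩
  ⨁[ x < suc n ] ((a * (b * x) ≡ᵇ n) ∧ f x)
    ≡⟨ ⨁-cong (suc n) (λ x _ → cong (λ m → (m ≡ᵇ n) ∧ f x) (sym (*-assoc a b x))) ⟩
  dilate (a * b) f n
    ∎
  where open ≡-Reasoning

dilate-⊛-section : ∀ k r m f g → r < k →
                   (dilate k f ⊛ g) (k * m + r) ≡ (f ⊛ (λ j → g (k * j + r))) m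
dilate-⊛-section k r m f g r<k = begin
  (dilate k f ⊛ g) N
    ≡⟨ ⊛-family g (dilate-family k (family-self {n = N} f ≤-refl)) ⟩
  ⨁[ x < suc N ] ((k * x <ᵇ suc N) ∧ (f x ∧ g (N ∸ k * x)))
    ≡⟨ ⨁-cong (suc N) (λ x _ → guard x) ⟩
  ⨁[ x < suc N ] ((x <ᵇ suc m) ∧ (f x ∧ g (k * (m ∸ x) + r)))
    ≡⟨ ⨁-below (λ x → f x ∧ g (k * (m ∸ x) + r)) (s≤s (≤-trans (m≤n*m m k) (m≤m+n (k * m) r))) ⟩
  (f ⊛ (λ j → g (k * j + r))) m
    ∎
  where
  open ≡-Reasoning
  N = k * m + r
  instance
    k-nonZero : NonZero k
    k-nonZero = >-nonZero (≤-<-trans z≤n r<k)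
  guard : ∀ x → (k * x <ᵇ suc N) ∧ (f x ∧ g (N ∸ k * x)) ≡ (x <ᵇ suc m) ∧ (f x ∧ g (k * (m ∸ x) + r))
  guard x with x ≤? m
  ... | yes x≤m = begin
    (k * x <ᵇ suc N) ∧ (f x ∧ g (N ∸ k * x))
      ≡⟨ cong₂ (λ b y → b ∧ (f x ∧ g y)) (dec-true (k * x <? suc N) (s≤s kx≤N)) N∸kx ⟩
    f x ∧ g (k * (m ∸ x) + r)
      ≡⟨ cong (_∧ (f x ∧ g (k * (m ∸ x) + r))) (dec-true (x <? suc m) (s≤s x≤m)) ⟨
    (x <ᵇ suc m) ∧ (f x ∧ g (k * (m ∸ x) + r))
      ∎
    where
    kx≤N : k * x ≤ N
    kx≤N = ≤-trans (*-monoʳ-≤ k x≤m) (m≤m+n (k * m) r)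
    N∸kx : N ∸ k * x ≡ k * (m ∸ x) + r
    N∸kx = begin
      k * m + r ∸ k * x    ≡⟨ +-∸-comm r (*-monoʳ-≤ k x≤m) ⟩
      (k * m ∸ k * x) + r  ≡⟨ cong (_+ r) (*-distribˡ-∸ k m x) ⟨
      k * (m ∸ x) + r      ∎
  ... | no x≰m = trans (cong (_∧ (f x ∧ g (N ∸ k * x))) (dec-false (k * x <? suc N) (<⇒≱ N<kx ∘ s≤s⁻¹)))
                       (sym (cong (_∧ (f x ∧ g (k * (m ∸ x) + r))) (dec-false (x <? suc m) (x≰m ∘ s≤s⁻¹))))
    where
    N<kx : N < k * x
    N<kx = <-≤-trans (subst (N <_) (trans (+-comm (k * m) k) (sym (*-suc k m))) (+-monoʳ-< (k * m) r<k))
                     (*-monoʳ-≤ k (≰⇒> x≰m))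

inverse-dilate₈ : ∀ {a F} → a ⊛ F ≗ 𝟙 → a ⊛ dilate 8 F ≗ F ⊛ (dilate 2 F ⊛ dilate 4 F)
inverse-dilate₈ {a} {F} a⊛F≗𝟙 = begin
  a ⊛ F₈
    ≈⟨ ⊛-congˡ a F₈-factors ⟩
  a ⊛ (F₄ ⊛ (F₂ ⊛ (F ⊛ F)))
    ≈⟨ solve 4 (λ a F F₂ F₄ → a ⊕ (F₄ ⊕ (F₂ ⊕ (F ⊕ F))) ⊜ (a ⊕ F) ⊕ (F ⊕ (F₂ ⊕ F₄)))
               (λ _ → refl) a F F₂ F₄ ⟩
  (a ⊛ F) ⊛ (F ⊛ (F₂ ⊛ F₄))
    ≈⟨ ⊛-congʳ (F ⊛ (F₂ ⊛ F₄)) a⊛F≗𝟙 ⟩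
  𝟙 ⊛ (F ⊛ (F₂ ⊛ F₄))
    ≈⟨ ⊛-identityˡ (F ⊛ (F₂ ⊛ F₄)) ⟩
  F ⊛ (F₂ ⊛ F₄)
    ∎
  where
  open CommutativeMonoidSolver ⊛-commutativeMonoid using (solve; _⊕_; _⊜_)
  open import Relation.Binary.Reasoning.Setoid (CommutativeMonoid.setoid ⊛-commutativeMonoid)
  F₂ F₄ F₈ : Series
  F₂ = dilate 2 F
  F₄ = dilate 4 F
  F₈ = dilate 8 F
  square : ∀ k .{{_ : NonZero k}} → dilate (2 * k) F ≗ dilate k F ⊛ dilate k F
  square k n = trans (sym (dilate-dilate 2 k F n)) (sym (frobenius (dilate k F) n))
  F₈-factors : F₈ ≗ F₄ ⊛ (F₂ ⊛ (F ⊛ F))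
  F₈-factors = begin
    F₈                        ≈⟨ square 4 ⟩
    F₄ ⊛ F₄                   ≈⟨ ⊛-congˡ F₄ (square 2) ⟩
    F₄ ⊛ (F₂ ⊛ F₂)            ≈⟨ ⊛-congˡ F₄ (⊛-congˡ F₂ (λ n → sym (frobenius F n))) ⟩
    F₄ ⊛ (F₂ ⊛ (F ⊛ F))       ∎


-- The coefficients of Ψ(−q^r, q^s) and of its inverse modulo 2

odd : ℕ → Bool
odd zero    = false
odd (suc n) = not (odd n)

odd-+ : ∀ m n → odd (m + n) ≡ odd m xor odd n
odd-+ zero    n = refl
odd-+ (suc m) n = trans (cong not (odd-+ m n)) (not-distribˡ-xor (odd m) (odd n))

odd-* : ∀ m n → odd (m * n) ≡ odd m ∧ odd n
odd-* zero    n = refl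
odd-* (suc m) n = trans (odd-+ n (m * n)) (trans (cong (odd n xor_) (odd-* m n)) (lemma (odd m) (odd n)))
  where
  lemma : ∀ a b → b xor (a ∧ b) ≡ not a ∧ b
  lemma false b = xor-identityʳ b
  lemma true  b = xor-same b

odd-∸ : ∀ {m n} → m ≤ n → odd (n ∸ m) ≡ odd n xor odd m
odd-∸ {m} {n} m≤n = begin
  odd (n ∸ m)                        ≡⟨ xor-identityʳ (odd (n ∸ m)) ⟨
  odd (n ∸ m) xor false              ≡⟨ cong (odd (n ∸ m) xor_) (xor-same (odd m)) ⟨
  odd (n ∸ m) xor (odd m xor odd m)  ≡⟨ xor-assoc (odd (n ∸ m)) (odd m) (odd m) ⟨
  (odd (n ∸ m) xor odd m) xor odd m  ≡⟨ cong (_xor odd m) (odd-+ (n ∸ m) m) ⟨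
  odd (n ∸ m + m) xor odd m          ≡⟨ cong (λ k → odd k xor odd m) (m∸n+n≡m m≤n) ⟩
  odd n xor odd m                    ∎
  where open ≡-Reasoning

odd-false⇒2∣ : ∀ n → odd n ≡ false → 2 ∣ℕ n
odd-false⇒2∣ zero          _    = 2 ∣0
odd-false⇒2∣ (suc (suc n)) even =
  ∣m∣n⇒∣m+n ∣-refl (odd-false⇒2∣ n (trans (sym (not-involutive (odd n))) even))

oddℤ : ℤ → Bool
oddℤ x = odd ℤ.∣ x ∣

oddℤ-neg : ∀ x → oddℤ (ℤ.- x) ≡ oddℤ x
oddℤ-neg x = cong odd (∣-i∣≡∣i∣ x)

oddℤ-* : ∀ x y → oddℤ (x ℤ.* y) ≡ oddℤ x ∧ oddℤ y
oddℤ-* x y = trans (cong odd (abs-* x y)) (odd-* ℤ.∣ x ∣ ℤ.∣ y ∣)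

oddℤ-⊖ : ∀ m n → oddℤ (m ⊖ n) ≡ odd m xor odd n
oddℤ-⊖ m n with ≤-total m n
... | inj₁ m≤n = trans (cong odd (∣⊖∣-≤ m≤n)) (trans (odd-∸ m≤n) (xor-comm (odd n) (odd m)))
... | inj₂ n≤m = trans (cong odd (trans (∣m⊖n∣≡∣n⊖m∣ m n) (∣⊖∣-≤ n≤m))) (odd-∸ n≤m)

oddℤ-+ : ∀ x y → oddℤ (x ℤ.+ y) ≡ oddℤ x xor oddℤ y
oddℤ-+ (+ m)     (+ n)     = odd-+ m n
oddℤ-+ (+ m)     -[1+ n ]  = oddℤ-⊖ m (suc n)
oddℤ-+ -[1+ m ]  (+ n)     = trans (oddℤ-⊖ n (suc m)) (xor-comm (odd n) (odd (suc m)))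
oddℤ-+ -[1+ m ]  -[1+ n ]  =
  trans (not-involutive (odd (m + n))) (trans (odd-+ m n) (sym (xor-annihilates-not (odd m) (odd n))))

oddℤ-- : ∀ x y → oddℤ (x ℤ.- y) ≡ oddℤ x xor oddℤ y
oddℤ-- x y = trans (oddℤ-+ x (ℤ.- y)) (cong (oddℤ x xor_) (oddℤ-neg y))

oddℤ-sum : ∀ n (g : ℕ → ℤ) → oddℤ (sumℤ (applyUpTo g n)) ≡ ⨁[ i < n ] oddℤ (g i)
oddℤ-sum zero    g = refl
oddℤ-sum (suc n) g = begin
  oddℤ (g 0 ℤ.+ sumℤ (applyUpTo (g ∘ suc) n))   ≡⟨ oddℤ-+ (g 0) _ ⟩
  oddℤ (g 0) xor oddℤ (sumℤ (applyUpTo (g ∘ suc) n))  ≡⟨ cong (oddℤ (g 0) xor_) (oddℤ-sum n (g ∘ suc)) ⟩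
  oddℤ (g 0) xor ⨁[ i < n ] oddℤ (g (suc i))    ≡⟨ ⨁-suc n (oddℤ ∘ g) ⟨
  ⨁[ i < suc n ] oddℤ (g i)                      ∎
  where open ≡-Reasoning

oddℤ-sum-upTo : ∀ n (g : ℕ → ℤ) → oddℤ (sumℤ (map g (upTo n))) ≡ ⨁[ i < n ] oddℤ (g i)
oddℤ-sum-upTo n g = trans (cong (oddℤ ∘ sumℤ) (map-applyUpTo id g n)) (oddℤ-sum n g)

oddℤ-sgn : ∀ k → oddℤ (sgn k) ≡ true
oddℤ-sgn zero    = refl
oddℤ-sgn (suc k) = trans (oddℤ-* ℤ.-1ℤ (sgn k)) (oddℤ-sgn k)

oddℤ-signed-indicator : ∀ b k → oddℤ (if b then sgn k else + 0) ≡ b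
oddℤ-signed-indicator true  k = oddℤ-sgn k
oddℤ-signed-indicator false k = refl

psiMod2 : ℕ → ℕ → Series
psiMod2 r s N = oddℤ (psiCoeff r s N)

cMod2 : ℕ → ℕ → Series
cMod2 r s N = oddℤ (c r s N)

psiMod2-coeff : ∀ r s N → psiMod2 r s N ≡
  ⨁[ n < suc N ] (posExp r s n ≡ᵇ N) xor ⨁[ i < N ] (negExp r s (suc i) ≡ᵇ N)
psiMod2-coeff r s N = trans (oddℤ-- (sumℤ (map pos (upTo (suc N)))) (sumℤ (map neg (upTo N)))) (cong₂ _xor_
  (trans (oddℤ-sum-upTo (suc N) pos)
         (⨁-cong (suc N) (λ n _ → oddℤ-signed-indicator (posExp r s n ≡ᵇ N) (tri n))))
  (trans (oddℤ-sum-upTo N neg) (⨁-cong N (λ i _ → oddℤ-signed-indicator (negExp r s (suc i) ≡ᵇ N) (tri i)))))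
  where
  pos neg : ℕ → ℤ
  pos n = if posExp r s n ≡ᵇ N then sgn (tri n) else + 0
  neg i = if negExp r s (suc i) ≡ᵇ N then sgn (tri i) else + 0

psiMod2-0 : ∀ r s → psiMod2 r s 0 ≡ true
psiMod2-0 r s = trans (psiMod2-coeff r s 0)
  (trans (xor-identityʳ _) (cong (_≡ᵇ 0) (cong₂ _+_ (*-zeroʳ r) (*-zeroʳ s))))

zipWith-applyUpTo : ∀ {A B C : Set} (f : A → B → C) (g : ℕ → A) (h : ℕ → B) n →
                    zipWith f (applyUpTo g n) (applyUpTo h n) ≡ applyUpTo (λ i → f (g i) (h i)) n
zipWith-applyUpTo f g h zero    = refl
zipWith-applyUpTo f g h (suc n) = cong (f (g 0) (h 0) ∷_) (zipWith-applyUpTo f (g ∘ suc) (h ∘ suc) n)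

toList-cs : ∀ r s N → toList (cs r s N) ≡ applyUpTo (λ i → c r s (N ∸ i)) (suc N)
toList-cs r s zero    = refl
toList-cs r s (suc N) = cong (c r s (suc N) ∷_) (toList-cs r s N)

cMod2-suc : ∀ r s N → cMod2 r s (suc N) ≡ ⨁[ i < suc N ] (psiMod2 r s (suc i) ∧ cMod2 r s (N ∸ i))
cMod2-suc r s N = begin
  oddℤ (ℤ.- sumℤ (zipWith ℤ._*_ (map (ψ ∘ suc) (upTo (suc N))) (toList (cs r s N))))
    ≡⟨ oddℤ-neg (sumℤ (zipWith ℤ._*_ (map (ψ ∘ suc) (upTo (suc N))) (toList (cs r s N)))) ⟩
  oddℤ (sumℤ (zipWith ℤ._*_ (map (ψ ∘ suc) (upTo (suc N))) (toList (cs r s N))))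
    ≡⟨ cong (oddℤ ∘ sumℤ) (cong₂ (zipWith ℤ._*_) (map-applyUpTo id (ψ ∘ suc) (suc N)) (toList-cs r s N)) ⟩
  oddℤ (sumℤ (zipWith ℤ._*_ (applyUpTo (ψ ∘ suc) (suc N)) (applyUpTo (λ i → c r s (N ∸ i)) (suc N))))
    ≡⟨ cong (oddℤ ∘ sumℤ) (zipWith-applyUpTo ℤ._*_ (ψ ∘ suc) (λ i → c r s (N ∸ i)) (suc N)) ⟩
  oddℤ (sumℤ (applyUpTo term (suc N)))
    ≡⟨ oddℤ-sum (suc N) term ⟩
  ⨁[ i < suc N ] oddℤ (term i)
    ≡⟨ ⨁-cong (suc N) (λ i _ → oddℤ-* (ψ (suc i)) (c r s (N ∸ i))) ⟩
  ⨁[ i < suc N ] (psiMod2 r s (suc i) ∧ cMod2 r s (N ∸ i))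
    ∎
  where
  open ≡-Reasoning
  ψ : ℕ → ℤ
  ψ = psiCoeff r s
  term : ℕ → ℤ
  term i = ψ (suc i) ℤ.* c r s (N ∸ i)

cMod2-inverse : ∀ r s → cMod2 r s ⊛ psiMod2 r s ≗ 𝟙
cMod2-inverse r s zero    = cong (_xor_ false) (cong (true ∧_) (psiMod2-0 r s))
cMod2-inverse r s (suc N) = begin
  (cMod2 r s ⊛ psiMod2 r s) (suc N)
    ≡⟨ ⊛-comm (cMod2 r s) (psiMod2 r s) (suc N) ⟩
  (psiMod2 r s ⊛ cMod2 r s) (suc N)
    ≡⟨ ⨁-suc (suc N) _ ⟩
  psiMod2 r s 0 ∧ cMod2 r s (suc N) xor ⨁[ i < suc N ] (psiMod2 r s (suc i) ∧ cMod2 r s (N ∸ i))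
    ≡⟨ cong₂ _xor_ (cong (_∧ cMod2 r s (suc N)) (psiMod2-0 r s)) (sym (cMod2-suc r s N)) ⟩
  cMod2 r s (suc N) xor cMod2 r s (suc N)
    ≡⟨ xor-same (cMod2 r s (suc N)) ⟩
  false
    ∎
  where open ≡-Reasoning


-- The theta series of the residues ±3 modulo 7

infixl 6 _+₇_
_+₇_ : ℕ → ℕ → ℕ
r +₇ s = (r + s) % 7

Cᵣ : ℕ → ℕ → Bool
Cᵣ a r = (r ≡ᵇ a) ∨ (r ≡ᵇ 7 ∸ a)

C± : ℕ → ℕ → Bool
C± a x = Cᵣ a (x % 7)

%7-+ : ∀ m n → (m + n) % 7 ≡ m % 7 +₇ n % 7
%7-+ m n = %-distribˡ-+ m n 7

C±-block : ∀ a q r → C± a (q * 7 + r) ≡ C± a r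
C±-block a q r = cong (Cᵣ a) (trans (cong (_% 7) (+-comm (q * 7) r)) ([m+kn]%n≡m%n r q 7))

C±-residue : ∀ a x → C± a x ≡ true → x ≡ 7 * (x / 7) + a ⊎ x ≡ 7 * (x / 7) + (7 ∸ a)
C±-residue a x x≡±a with x % 7 ≡ᵇ a in r≡a
... | true  = inj₁ (%-decompose 7 (≡ᵇ-true⇒≡ r≡a))
... | false = inj₂ (%-decompose 7 (≡ᵇ-true⇒≡ x≡±a))

-- Exact only for x ≡ ±3 (mod 7).
E : ℕ → ℕ
E x = (x * x ∸ 9) / 7

E-unique : ∀ x e → x * x ≡ 7 * e + 9 → E x ≡ e
E-unique x e eq = begin
  (x * x ∸ 9) / 7      ≡⟨ cong (λ m → (m ∸ 9) / 7) eq ⟩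
  (7 * e + 9 ∸ 9) / 7  ≡⟨ cong (_/ 7) (trans (m+n∸n≡m (7 * e) 9) (*-comm 7 e)) ⟩
  e * 7 / 7            ≡⟨ m*n/n≡m e 7 ⟩
  e                    ∎
  where open ≡-Reasoning

square₃ : ∀ q → (q * 7 + 3) * (q * 7 + 3) ≡ 7 * (7 * (q * q) + 6 * q) + 9
square₃ = solve-∀

square₄ : ∀ q → (q * 7 + 4) * (q * 7 + 4) ≡ 7 * (7 * (q * q) + 8 * q + 1) + 9
square₄ = solve-∀

E-block₃ : ∀ q → E (q * 7 + 3) ≡ 7 * (q * q) + 6 * q
E-block₃ q = E-unique (q * 7 + 3) _ (square₃ q)

E-block₄ : ∀ q → E (q * 7 + 4) ≡ 7 * (q * q) + 8 * q + 1
E-block₄ q = E-unique (q * 7 + 4) _ (square₄ q)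

C±3-square : ∀ x → C± 3 x ≡ true → x * x ≡ 7 * E x + 9
C±3-square x h with C±-residue 3 x h
... | inj₁ x≡ = subst (λ y → y * y ≡ 7 * E y + 9) (sym (trans x≡ (cong (_+ 3) (*-comm 7 (x / 7)))))
                      (trans (square₃ (x / 7)) (cong (λ e → 7 * e + 9) (sym (E-block₃ (x / 7)))))
... | inj₂ x≡ = subst (λ y → y * y ≡ 7 * E y + 9) (sym (trans x≡ (cong (_+ 4) (*-comm 7 (x / 7)))))
                      (trans (square₄ (x / 7)) (cong (λ e → 7 * e + 9) (sym (E-block₄ (x / 7)))))

tri-double : ∀ n → 2 * tri n ≡ n * suc n
tri-double n = m*[n/m]≡n (odd-false⇒2∣ (n * suc n) (trans (odd-* n (suc n)) (∧-inverseʳ (odd n))))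

posExp-13-1 : ∀ q → posExp 13 1 q ≡ 7 * (q * q) + 6 * q
posExp-13-1 zero    = refl
posExp-13-1 (suc p) = *-cancelˡ-≡ _ _ 2 (begin
  2 * (13 * tri (suc p) + 1 * tri p)      ≡⟨ expand (tri (suc p)) (tri p) ⟩
  13 * (2 * tri (suc p)) + 2 * tri p      ≡⟨ cong₂ (λ a b → 13 * a + b) (tri-double (suc p)) (tri-double p) ⟩
  13 * (suc p * suc (suc p)) + p * suc p  ≡⟨ collect p ⟩
  2 * (7 * (suc p * suc p) + 6 * suc p)   ∎)
  where
  open ≡-Reasoning
  expand : ∀ t u → 2 * (13 * t + 1 * u) ≡ 13 * (2 * t) + 2 * u
  expand = solve-∀
  collect : ∀ p → 13 * (suc p * suc (suc p)) + p * suc p ≡ 2 * (7 * (suc p * suc p) + 6 * suc p)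
  collect = solve-∀

negExp-13-1 : ∀ q → negExp 13 1 (suc q) ≡ 7 * (q * q) + 8 * q + 1
negExp-13-1 q = *-cancelˡ-≡ _ _ 2 (begin
  2 * (13 * tri q + 1 * tri (suc q))      ≡⟨ expand (tri q) (tri (suc q)) ⟩
  13 * (2 * tri q) + 2 * tri (suc q)      ≡⟨ cong₂ (λ a b → 13 * a + b) (tri-double q) (tri-double (suc q)) ⟩
  13 * (q * suc q) + suc q * suc (suc q)  ≡⟨ collect q ⟩
  2 * (7 * (q * q) + 8 * q + 1)           ∎)
  where
  open ≡-Reasoning
  expand : ∀ t u → 2 * (13 * t + 1 * u) ≡ 13 * (2 * t) + 2 * u
  expand = solve-∀
  collect : ∀ q → 13 * (q * suc q) + suc q * suc (suc q) ≡ 2 * (7 * (q * q) + 8 * q + 1)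
  collect = solve-∀

-- θ(q) = Σ q^((x²−9)/7) over x ≡ ±3 (mod 7): the exponents of x = 7n + 3 and x = 7n + 4 are those of
-- the terms of index n and −1 − n of Ψ(−q¹³, q).
θ : Series
θ n = ⨁[ x < n + 4 ] ((E x ≡ᵇ n) ∧ C± 3 x)

E-grows : ∀ n x → n + 4 ≤ x → C± 3 x ≡ true → n < E x
E-grows n x n+4≤x h = ≰⇒> λ Ex≤n → <⇒≱ (too-small Ex≤n) (*-mono-≤ n+4≤x n+4≤x)
  where
  too-small : E x ≤ n → x * x < (n + 4) * (n + 4)
  too-small Ex≤n = begin-strict
    x * x                  ≡⟨ C±3-square x h ⟩
    7 * E x + 9            ≤⟨ +-monoˡ-≤ 9 (*-monoʳ-≤ 7 Ex≤n) ⟩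
    7 * n + 9              <⟨ m<m+n (7 * n + 9) (s≤s z≤n) ⟩
    7 * n + 9 + suc (n * n + n + 6) ≡⟨ gap n ⟩
    (n + 4) * (n + 4)      ∎
    where
    open ≤-Reasoning
    gap : ∀ n → 7 * n + 9 + suc (n * n + n + 6) ≡ (n + 4) * (n + 4)
    gap = solve-∀

θ-family : ∀ {L n} → n + 4 ≤ L → Family L E (C± 3) n θ
θ-family {L} {n} n+4≤L = family λ i i≤n →
  sym (⨁-extend _ (≤-trans (+-monoˡ-≤ 4 i≤n) n+4≤L) (λ x i+4≤x _ → vanish i x i+4≤x))
  where
  vanish : ∀ i x → i + 4 ≤ x → (E x ≡ᵇ i) ∧ C± 3 x ≡ false
  vanish i x i+4≤x with C± 3 x in h
  ... | true  = trans (∧-identityʳ _) (dec-false (E x ≟ i) (>⇒≢ (E-grows i x i+4≤x h)))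
  ... | false = ∧-zeroʳ _

θ-block : ∀ q n → ⨁[ r < 7 ] ((E (q * 7 + r) ≡ᵇ n) ∧ C± 3 (q * 7 + r)) ≡
                  (posExp 13 1 q ≡ᵇ n) xor (negExp 13 1 (suc q) ≡ᵇ n)
θ-block q n = begin
  ⨁[ r < 7 ] ((E (q * 7 + r) ≡ᵇ n) ∧ C± 3 (q * 7 + r))
    ≡⟨ ⨁-cong 7 (λ r _ → trans (∧-comm (E (q * 7 + r) ≡ᵇ n) (C± 3 (q * 7 + r)))
                               (cong (_∧ (E (q * 7 + r) ≡ᵇ n)) (C±-block 3 q r))) ⟩
  ⨁[ r < 7 ] (C± 3 r ∧ (E (q * 7 + r) ≡ᵇ n))
    ≡⟨ trans (xor-identityʳ _) (xor-identityʳ _) ⟩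
  (E (q * 7 + 3) ≡ᵇ n) xor (E (q * 7 + 4) ≡ᵇ n)
    ≡⟨ cong₂ _xor_ (cong (_≡ᵇ n) (trans (E-block₃ q) (sym (posExp-13-1 q))))
                   (cong (_≡ᵇ n) (trans (E-block₄ q) (sym (negExp-13-1 q)))) ⟩
  (posExp 13 1 q ≡ᵇ n) xor (negExp 13 1 (suc q) ≡ᵇ n)
    ∎
  where open ≡-Reasoning

psiMod2≗θ : psiMod2 13 1 ≗ θ
psiMod2≗θ n = sym (begin
  θ n
    ≡⟨ coeff (θ-family n+4≤7+7n) n ≤-refl ⟩
  ⨁[ x < suc n * 7 ] ((E x ≡ᵇ n) ∧ C± 3 x)
    ≡⟨ ⨁-blocks (suc n) 7 _ ⟩
  ⨁[ q < suc n ] ⨁[ r < 7 ] ((E (q * 7 + r) ≡ᵇ n) ∧ C± 3 (q * 7 + r))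
    ≡⟨ ⨁-cong (suc n) (λ q _ → θ-block q n) ⟩
  ⨁[ q < suc n ] ((posExp 13 1 q ≡ᵇ n) xor (negExp 13 1 (suc q) ≡ᵇ n))
    ≡⟨ ⨁-xor (suc n) _ _ ⟩
  positive xor (negative xor (negExp 13 1 (suc n) ≡ᵇ n))
    ≡⟨ cong (λ b → positive xor (negative xor b)) (dec-false (negExp 13 1 (suc n) ≟ n) (>⇒≢ n<negExp)) ⟩
  positive xor (negative xor false)
    ≡⟨ cong (positive xor_) (xor-identityʳ negative) ⟩
  positive xor negative
    ≡⟨ psiMod2-coeff 13 1 n ⟨
  psiMod2 13 1 n
    ∎)
  where
  open ≡-Reasoning
  positive = ⨁[ q < suc n ] (posExp 13 1 q ≡ᵇ n)
  negative = ⨁[ q < n ] (negExp 13 1 (suc q) ≡ᵇ n)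
  n+4≤7+7n : n + 4 ≤ suc n * 7
  n+4≤7+7n = subst (n + 4 ≤_) (+-comm (n * 7) 7) (+-mono-≤ (m≤m*n n 7) (≤ᵇ⇒≤ 4 7 _))
  n<negExp : n < negExp 13 1 (suc n)
  n<negExp = subst (n <_) (sym (negExp-13-1 n))
    (≤-<-trans (≤-trans (m≤n*m n 8) (m≤n+m (8 * n) (7 * (n * n)))) (m<m+n _ (s≤s z≤n)))

θ-0 : θ 0 ≡ true
θ-0 = refl


-- Halving sums of two squares

R : (ℕ → Bool) → (ℕ → Bool) → ℕ → ℕ → Bool
R A B m T = ⨁[ u < suc T ] ⨁[ w < suc T ] ((u * u + w * w + m ≡ᵇ T) ∧ (A u ∧ B w))

squares-bound : ∀ {a b m N} → a * a + b * b + m ≡ N → a < suc N × b < suc N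
squares-bound {a} {b} {m} refl =
  s≤s (≤-trans (n≤n*n a) (≤-trans (m≤m+n (a * a) (b * b)) (m≤m+n _ m))) ,
  s≤s (≤-trans (n≤n*n b) (≤-trans (m≤n+m (b * b) (a * a)) (m≤m+n _ m)))

squares-exceed : ∀ {u w m T} → T < u ⊎ T < w → (u * u + w * w + m ≡ᵇ T) ≡ false
squares-exceed {u} {w} {m} {T} (inj₁ T<u) =
  dec-false (u * u + w * w + m ≟ T) λ eq → <⇒≱ T<u (s≤s⁻¹ (proj₁ (squares-bound {u} {w} eq)))
squares-exceed {u} {w} {m} {T} (inj₂ T<w) =
  dec-false (u * u + w * w + m ≟ T) λ eq → <⇒≱ T<w (s≤s⁻¹ (proj₂ (squares-bound {u} {w} eq)))

R-bound : ∀ A B m T {L} → suc T ≤ L →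
          R A B m T ≡ ⨁[ u < L ] ⨁[ w < L ] ((u * u + w * w + m ≡ᵇ T) ∧ (A u ∧ B w))
R-bound A B m T {L} T<L = sym (trans
  (⨁-extend _ T<L (λ u T<u _ → ⨁-false L (λ w _ →
     cong (_∧ (A u ∧ B w)) (squares-exceed {u} {w} {m} (inj₁ T<u)))))
  (⨁-cong (suc T) (λ u _ → ⨁-extend _ T<L (λ w T<w _ →
     cong (_∧ (A u ∧ B w)) (squares-exceed {u} {w} {m} (inj₂ T<w))))))

orient : (ℕ → Bool) → ℕ → ℕ → ℕ × ℕ
orient A p q = if A p then (p , q) else (q , p)

Good : (ℕ → Bool) → (ℕ → Bool) → ℕ → ℕ → Bool
Good A B p q = if A p then B q else A q ∧ B p

orient-symmetric : ∀ {X : Set} A p q (h : ℕ → ℕ → X) → (∀ u w → h u w ≡ h w u) →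
                   uncurry h (orient A p q) ≡ h p q
orient-symmetric A p q h h-sym with A p
... | true  = refl
... | false = h-sym q p

orient-good : ∀ A B p q → Good A B p q ≡ true → uncurry (λ u w → A u ∧ B w) (orient A p q) ≡ true
orient-good A B p q good with A p in Ap
... | true  = trans (cong (_∧ B q) Ap) good
... | false = good

orient-box : ∀ A {p q n} → p < n × q < n → proj₁ (orient A p q) < n × proj₂ (orient A p q) < n
orient-box A {p} (p<n , q<n) with A p
... | true  = p<n , q<n
... | false = q<n , p<n

orient-true : ∀ A {p} q → A p ≡ true → orient A p q ≡ (p , q)
orient-true A q Ap rewrite Ap = refl

orient-false : ∀ A {p} q → A p ≡ false → orient A p q ≡ (q , p)
orient-false A q Ap rewrite Ap = refl

-- Class conditions making (x, z) ↦ orient A′ ((x+z)/2, |x−z|/2) and (u, w) ↦ orient A (u+w, |u−w|)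
-- inverse bijections between the solutions with x ∈ A, z ∈ B and those with u ∈ A′, w ∈ B′; the
-- four cases are x = z + 2t, z = x + 2t, u = w + d and w = u + d.
record Halving (A B A′ B′ : ℕ → Bool) : Set where
  field
    B⇒¬A   : ∀ x → B x ≡ true → A x ≡ false
    B′⇒¬A′ : ∀ x → B′ x ≡ true → A′ x ≡ false
    down₁  : ∀ z t → A (z + t + t) ≡ true → B z ≡ true → Good A′ B′ (z + t) t ≡ true
    down₂  : ∀ x t → A x ≡ true → B (x + t + t) ≡ true → Good A′ B′ (x + t) t ≡ true
    up₁    : ∀ w d → A′ (w + d) ≡ true → B′ w ≡ true → Good A B (w + d + w) d ≡ true
    up₂    : ∀ u d → A′ u ≡ true → B′ (u + d) ≡ true → Good A B (u + (u + d)) d ≡ true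

same-parity-gap : ∀ {z x} → z ≤ x → odd x ≡ odd z → ∃ λ t → x ≡ z + t + t
same-parity-gap {z} {x} z≤x odd≡
  with odd-false⇒2∣ (x ∸ z) (trans (odd-∸ z≤x) (trans (cong (_xor odd z) odd≡) (xor-same (odd z))))
... | divides t x∸z≡t*2 = t , (begin
  x                ≡⟨ m+[n∸m]≡n z≤x ⟨
  z + (x ∸ z)      ≡⟨ cong (_+_ z) (trans x∸z≡t*2 (*-comm t 2)) ⟩
  z + 2 * t        ≡⟨ shape z t ⟩
  z + t + t        ∎)
  where
  open ≡-Reasoning
  shape : ∀ z t → z + 2 * t ≡ z + t + t
  shape = solve-∀

same-parity-squares : ∀ x z m K → x * x + z * z + 2 * m ≡ 2 * K → odd x ≡ odd z
same-parity-squares x z m K eq = xor-false⇒≡ (begin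
  odd x xor odd z                                    ≡⟨ xor-identityʳ _ ⟨
  (odd x xor odd z) xor false                        ≡⟨ cong₂ (λ a b → (a xor b) xor false)
                                                              (odd-square x) (odd-square z) ⟨
  (odd (x * x) xor odd (z * z)) xor false            ≡⟨ cong ((odd (x * x) xor odd (z * z)) xor_) (odd-* 2 m) ⟨
  (odd (x * x) xor odd (z * z)) xor odd (2 * m)      ≡⟨ cong (_xor odd (2 * m)) (odd-+ (x * x) (z * z)) ⟨
  odd (x * x + z * z) xor odd (2 * m)                ≡⟨ odd-+ (x * x + z * z) (2 * m) ⟨
  odd (x * x + z * z + 2 * m)                        ≡⟨ cong odd eq ⟩
  odd (2 * K)                                        ≡⟨ odd-* 2 K ⟩
  false                                              ∎)
  where
  open ≡-Reasoning
  odd-square : ∀ n → odd (n * n) ≡ odd n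
  odd-square n = trans (odd-* n n) (∧-idem (odd n))

module _ {A B A′ B′ : ℕ → Bool} (H : Halving A B A′ B′) (m K : ℕ) where
  open Halving H

  private
    S₂ S₁ : ℕ → ℕ → Bool
    S₂ x z = x * x + z * z + 2 * m ≡ᵇ 2 * K
    S₁ u w = u * u + w * w + m ≡ᵇ K

    S₂-sym : ∀ x z → S₂ x z ≡ S₂ z x
    S₂-sym x z = cong (λ s → s + 2 * m ≡ᵇ 2 * K) (+-comm (x * x) (z * z))

    S₁-sym : ∀ u w → S₁ u w ≡ S₁ w u
    S₁-sym u w = cong (λ s → s + m ≡ᵇ K) (+-comm (u * u) (w * w))

    P Q : ℕ → ℕ → Bool
    P x z = S₂ x z ∧ (A x ∧ B z)
    Q u w = S₁ u w ∧ (A′ u ∧ B′ w)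

    down-map up-map : ℕ → ℕ → ℕ × ℕ
    down-map x z = orient A′ ((x + z) / 2) (∣ x - z ∣ / 2)
    up-map   u w = orient A (u + w) ∣ u - w ∣

    up-map-sym : ∀ u w → up-map u w ≡ up-map w u
    up-map-sym u w = cong₂ (orient A) (+-comm u w) (∣-∣-comm u w)

    down-map-sym : ∀ x z → down-map x z ≡ down-map z x
    down-map-sym x z = cong₂ (λ s d → orient A′ (s / 2) (d / 2)) (+-comm x z) (∣-∣-comm x z)

    Down : ℕ → ℕ → ℕ → ℕ → Set
    Down x z p q = p * p + q * q + m ≡ K × Good A′ B′ p q ≡ true × up-map p q ≡ (x , z)

    Up : ℕ → ℕ → ℕ → ℕ → Set
    Up u w s d = s * s + d * d + 2 * m ≡ 2 * K × Good A B s d ≡ true × down-map s d ≡ (u , w)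

    down-right : ∀ z t → (z + t + t) * (z + t + t) + z * z + 2 * m ≡ 2 * K →
                 A (z + t + t) ≡ true → B z ≡ true → Down (z + t + t) z (z + t) t
    down-right z t eq Ax Bz =
      *-cancelˡ-≡ _ _ 2 (trans (identity z t m) eq) ,
      down₁ z t Ax Bz ,
      trans (cong (orient A (z + t + t)) (∣m+n-n∣≡m z t)) (orient-true A z Ax)
      where
      identity : ∀ z t m → 2 * ((z + t) * (z + t) + t * t + m) ≡ (z + t + t) * (z + t + t) + z * z + 2 * m
      identity = solve-∀

    down-left : ∀ x t → x * x + (x + t + t) * (x + t + t) + 2 * m ≡ 2 * K →
                A x ≡ true → B (x + t + t) ≡ true → Down x (x + t + t) (x + t) t
    down-left x t eq Ax Bz =
      *-cancelˡ-≡ _ _ 2 (trans (identity x t m) eq) ,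
      down₂ x t Ax Bz ,
      trans (cong (orient A (x + t + t)) (∣m+n-n∣≡m x t)) (orient-false A x (B⇒¬A _ Bz))
      where
      identity : ∀ x t m → 2 * ((x + t) * (x + t) + t * t + m) ≡ x * x + (x + t + t) * (x + t + t) + 2 * m
      identity = solve-∀

    up-right : ∀ w d → (w + d) * (w + d) + w * w + m ≡ K → A′ (w + d) ≡ true → B′ w ≡ true →
               Up (w + d) w (w + d + w) d
    up-right w d eq Au Bw =
      trans (identity w d m) (cong (2 *_) eq) ,
      up₁ w d Au Bw ,
      trans (cong₂ (orient A′) (halve (w + d) (sum w d))
                               (halve w (trans (cong ∣_- d ∣ (sum′ w d)) (∣m+n-n∣≡m (w + w) d))))
            (orient-true A′ w Au)
      where
      sum : ∀ w d → w + d + w + d ≡ (w + d) + (w + d)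
      sum = solve-∀
      sum′ : ∀ w d → w + d + w ≡ w + w + d
      sum′ = solve-∀
      identity : ∀ w d m → (w + d + w) * (w + d + w) + d * d + 2 * m ≡ 2 * ((w + d) * (w + d) + w * w + m)
      identity = solve-∀

    up-left : ∀ u d → u * u + (u + d) * (u + d) + m ≡ K → A′ u ≡ true → B′ (u + d) ≡ true →
              Up u (u + d) (u + (u + d)) d
    up-left u d eq Au Bw =
      trans (identity u d m) (cong (2 *_) eq) ,
      up₂ u d Au Bw ,
      trans (cong₂ (orient A′) (halve (u + d) (sum u d))
                               (halve u (trans (cong ∣_- d ∣ (sum′ u d)) (∣m+n-n∣≡m (u + u) d))))
            (orient-false A′ u (B′⇒¬A′ _ Bw))
      where
      sum : ∀ u d → u + (u + d) + d ≡ (u + d) + (u + d)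
      sum = solve-∀
      sum′ : ∀ u d → u + (u + d) ≡ u + u + d
      sum′ = solve-∀
      identity : ∀ u d m → (u + (u + d)) * (u + (u + d)) + d * d + 2 * m ≡ 2 * (u * u + (u + d) * (u + d) + m)
      identity = solve-∀

    down : ∀ x z → P x z ≡ true → Down x z ((x + z) / 2) (∣ x - z ∣ / 2)
    down x z Pxz with ∧₃-true {S₂ x z} {A x} {B z} Pxz
    ... | S₂xz , Ax , Bz with ≡ᵇ-true⇒≡ {x * x + z * z + 2 * m} {2 * K} S₂xz | ≤-total z x
    ...   | eq | inj₁ z≤x with same-parity-gap z≤x (same-parity-squares x z m K eq)
    ...     | t , refl = subst₂ (Down (z + t + t) z) (sym (halve (z + t) (sum z t))) (sym (halve t diff))
                                (down-right z t eq Ax Bz)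
      where
      sum : ∀ z t → z + t + t + z ≡ (z + t) + (z + t)
      sum = solve-∀
      diff : ∣ z + t + t - z ∣ ≡ t + t
      diff = trans (cong ∣_- z ∣ (+-assoc z t t)) (trans (∣-∣-comm (z + (t + t)) z) (∣m-m+n∣≡n z (t + t)))
    down x z Pxz | S₂xz , Ax , Bz | eq | inj₂ x≤z with same-parity-gap x≤z (sym (same-parity-squares x z m K eq))
    ...     | t , refl = subst₂ (Down x (x + t + t)) (sym (halve (x + t) (sum x t))) (sym (halve t diff))
                                (down-left x t eq Ax Bz)
      where
      sum : ∀ x t → x + (x + t + t) ≡ (x + t) + (x + t)
      sum = solve-∀
      diff : ∣ x - x + t + t ∣ ≡ t + t
      diff = trans (cong ∣ x -_∣ (+-assoc x t t)) (∣m-m+n∣≡n x (t + t))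

    up : ∀ u w → Q u w ≡ true → Up u w (u + w) ∣ u - w ∣
    up u w Quw with ∧₃-true {S₁ u w} {A′ u} {B′ w} Quw
    ... | S₁uw , Au , Bw with ≡ᵇ-true⇒≡ {u * u + w * w + m} {K} S₁uw | ≤-total w u
    ...   | eq | inj₁ w≤u with m≤n⇒∃[o]m+o≡n w≤u
    ...     | d , refl = subst (Up (w + d) w (w + d + w)) (sym (trans (∣-∣-comm (w + d) w) (∣m-m+n∣≡n w d)))
                               (up-right w d eq Au Bw)
    up u w Quw | S₁uw , Au , Bw | eq | inj₂ u≤w with m≤n⇒∃[o]m+o≡n u≤w
    ...     | d , refl = subst (Up u (u + d) (u + (u + d))) (sym (∣m-m+n∣≡n u d)) (up-left u d eq Au Bw)

    halving-bijection : BoxBijection (suc (2 * K)) (suc K) P Q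
    halving-bijection = record
      { to        = down-map
      ; from      = up-map
      ; to-box    = λ {x} {z} Pxz → orient-box A′ (squares-bound (proj₁ (down x z Pxz)))
      ; from-box  = λ {u} {w} Quw → orient-box A (squares-bound (proj₁ (up u w Quw)))
      ; to-sat    = λ {x} {z} Pxz → let (norm , good , _) = down x z Pxz in
                      cong₂ _∧_ (trans (orient-symmetric A′ _ _ S₁ S₁-sym) (dec-true (_ ≟ K) norm))
                                (orient-good A′ B′ _ _ good)
      ; from-sat  = λ {u} {w} Quw → let (norm , good , _) = up u w Quw in
                      cong₂ _∧_ (trans (orient-symmetric A _ _ S₂ S₂-sym) (dec-true (_ ≟ 2 * K) norm))
                                (orient-good A B _ _ good)
      ; from-to   = λ {x} {z} Pxz → trans (orient-symmetric A′ _ _ up-map up-map-sym) (proj₂ (proj₂ (down x z Pxz)))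
      ; to-from   = λ {u} {w} Quw → trans (orient-symmetric A _ _ down-map down-map-sym) (proj₂ (proj₂ (up u w Quw)))
      }

  halving : R A B (2 * m) (2 * K) ≡ R A′ B′ m K
  halving = ⨁²-bijection halving-bijection

module _ (a b a′ b′ : ℕ) where

  private
    Implies₂ : Bool → Bool → Bool → Set
    Implies₂ x y z = x ≡ true → y ≡ true → z ≡ true

    implies₂? : ∀ x y z → Dec (Implies₂ x y z)
    implies₂? x y z = (x ≟ᵇ true) →-dec (y ≟ᵇ true) →-dec (z ≟ᵇ true)

    disjoint? : ∀ (A B : ℕ → Bool) r → Dec (B r ≡ true → A r ≡ false)
    disjoint? A B r = (B r ≟ᵇ true) →-dec (A r ≟ᵇ false)

  HalvingResidues : ℕ → ℕ → Set
  HalvingResidues r t =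
    (Cᵣ b r ≡ true → Cᵣ a r ≡ false) ×
    (Cᵣ b′ r ≡ true → Cᵣ a′ r ≡ false) ×
    Implies₂ (Cᵣ a (r +₇ t +₇ t)) (Cᵣ b r) (Good (Cᵣ a′) (Cᵣ b′) (r +₇ t) t) ×
    Implies₂ (Cᵣ a r) (Cᵣ b (r +₇ t +₇ t)) (Good (Cᵣ a′) (Cᵣ b′) (r +₇ t) t) ×
    Implies₂ (Cᵣ a′ (r +₇ t)) (Cᵣ b′ r) (Good (Cᵣ a) (Cᵣ b) (r +₇ t +₇ r) t) ×
    Implies₂ (Cᵣ a′ r) (Cᵣ b′ (r +₇ t)) (Good (Cᵣ a) (Cᵣ b) (r +₇ (r +₇ t)) t)

  halvingResidues? : ∀ r t → Dec (HalvingResidues r t)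
  halvingResidues? r t =
    disjoint? (Cᵣ a) (Cᵣ b) r ×-dec
    disjoint? (Cᵣ a′) (Cᵣ b′) r ×-dec
    implies₂? _ _ _ ×-dec implies₂? _ _ _ ×-dec implies₂? _ _ _ ×-dec implies₂? _ _ _

  halving-mod7 : {True (allUpTo? (λ r → allUpTo? (halvingResidues? r) 7) 7)} →
                 Halving (C± a) (C± b) (C± a′) (C± b′)
  halving-mod7 {ok} = record
    { B⇒¬A   = λ x → let (disjoint , _) = residues x 0 in disjoint
    ; B′⇒¬A′ = λ x → let (_ , disjoint′ , _) = residues x 0 in disjoint′
    ; down₁  = λ z t Ax Bz → let (_ , _ , down₁ᵣ , _) = residues z t in
        transport (λ s → Good (Cᵣ a′) (Cᵣ b′) s (t % 7)) (sym (%7-+ z t))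
                  (down₁ᵣ (transport (Cᵣ a) (%7-+₃ z t t) Ax) Bz)
    ; down₂  = λ x t Ax Bx → let (_ , _ , _ , down₂ᵣ , _) = residues x t in
        transport (λ s → Good (Cᵣ a′) (Cᵣ b′) s (t % 7)) (sym (%7-+ x t))
                  (down₂ᵣ Ax (transport (Cᵣ b) (%7-+₃ x t t) Bx))
    ; up₁    = λ w d Au Bw → let (_ , _ , _ , _ , up₁ᵣ , _) = residues w d in
        transport (λ s → Good (Cᵣ a) (Cᵣ b) s (d % 7)) (sym (%7-+₃ w d w))
                  (up₁ᵣ (transport (Cᵣ a′) (%7-+ w d) Au) Bw)
    ; up₂    = λ u d Au Bw → let (_ , _ , _ , _ , _ , up₂ᵣ) = residues u d in
        transport (λ s → Good (Cᵣ a) (Cᵣ b) s (d % 7)) (sym (%7-+₂ u d))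
                  (up₂ᵣ Au (transport (Cᵣ b′) (%7-+ u d) Bw))
    }
    where
    residues : ∀ x y → HalvingResidues (x % 7) (y % 7)
    residues x y = toWitness ok (m%n<n x 7) (m%n<n y 7)
    transport : ∀ {m n} (F : ℕ → Bool) → m ≡ n → F m ≡ true → F n ≡ true
    transport F m≡n = subst (λ k → F k ≡ true) m≡n
    %7-+₃ : ∀ m n o → (m + n + o) % 7 ≡ m % 7 +₇ n % 7 +₇ o % 7
    %7-+₃ m n o = trans (%7-+ (m + n) o) (cong (_+₇ o % 7) (%7-+ m n))
    %7-+₂ : ∀ m n → (m + (m + n)) % 7 ≡ m % 7 +₇ (m % 7 +₇ n % 7)
    %7-+₂ m n = trans (%7-+ m (m + n)) (cong (m % 7 +₇_) (%7-+ m n))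

halving₁₂ : Halving (C± 1) (C± 2) (C± 2) (C± 3)
halving₁₂ = halving-mod7 1 2 2 3

halving₂₃ : Halving (C± 2) (C± 3) (C± 3) (C± 1)
halving₂₃ = halving-mod7 2 3 3 1

halving₃₁ : Halving (C± 3) (C± 1) (C± 1) (C± 2)
halving₃₁ = halving-mod7 3 1 1 2

C±3-double : ∀ k → C± 3 (k * 2) ≡ C± 2 k
C±3-double k = trans (cong (Cᵣ 3) (trans (cong (_% 7) k*2≡k+k) (%7-+ k k)))
                     (toWitness {a? = allUpTo? (λ r → Cᵣ 3 (r +₇ r) ≟ᵇ Cᵣ 2 r) 7} _ (m%n<n k 7))
  where
  k*2≡k+k : k * 2 ≡ k + k
  k*2≡k+k = trans (*-comm k 2) (cong (_+_ k) (+-identityʳ k))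


-- Representations by x² + 2y² + 4z² and by x² + u² + w²

Q₁₂₄ : ℕ → ℕ → Bool
Q₁₂₄ L N =
  ⨁[ x < L ] ⨁[ y < L ] ⨁[ z < L ] ((x * x + 2 * (y * y) + 4 * (z * z) ≡ᵇ N) ∧ (C± 3 x ∧ (C± 3 y ∧ C± 3 z)))

Q₃₁₂ : ℕ → ℕ → Bool
Q₃₁₂ L N =
  ⨁[ x < L ] ⨁[ u < L ] ⨁[ w < L ] ((x * x + (u * u + w * w) ≡ᵇ N) ∧ (C± 3 x ∧ (C± 1 u ∧ C± 2 w)))

W : Series
W = dilate 2 θ ⊛ dilate 4 θ

W-coeff : ∀ {L j} → j + 4 ≤ L →
          W j ≡ ⨁[ y < L ] ⨁[ z < L ] ((2 * E y + 4 * E z ≡ᵇ j) ∧ (C± 3 y ∧ C± 3 z))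
W-coeff {L} {j} j+4≤L = begin
  W j
    ≡⟨ ⊛-family (dilate 4 θ) (dilate-family 2 (θ-family j+4≤L)) ⟩
  ⨁[ y < L ] ((2 * E y <ᵇ suc j) ∧ (C± 3 y ∧ dilate 4 θ (j ∸ 2 * E y)))
    ≡⟨ ⨁-cong L (λ y _ → cong (λ t → (2 * E y <ᵇ suc j) ∧ (C± 3 y ∧ t))
                              (coeff (dilate-family 4 (θ-family j+4≤L)) (j ∸ 2 * E y) (m∸n≤m j (2 * E y)))) ⟩
  ⨁[ y < L ] ((2 * E y <ᵇ suc j) ∧ (C± 3 y ∧ ⨁[ z < L ] ((4 * E z ≡ᵇ j ∸ 2 * E y) ∧ C± 3 z)))
    ≡⟨ ⨁-cong L (λ y _ → ∧-⨁-shift L (2 * E y) j (C± 3 y) (λ z → 4 * E z) (C± 3)) ⟩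
  ⨁[ y < L ] ⨁[ z < L ] ((2 * E y + 4 * E z ≡ᵇ j) ∧ (C± 3 y ∧ C± 3 z))
    ∎
  where open ≡-Reasoning

θ-cube : ∀ {L} N → N + 4 ≤ L → (θ ⊛ W) N ≡ Q₁₂₄ L (7 * N + 63)
θ-cube {L} N N+4≤L = begin
  (θ ⊛ W) N
    ≡⟨ ⊛-family W (θ-family N+4≤L) ⟩
  ⨁[ x < L ] ((E x <ᵇ suc N) ∧ (C± 3 x ∧ W (N ∸ E x)))
    ≡⟨ ⨁-cong L (λ x _ → trans (cong (λ t → (E x <ᵇ suc N) ∧ (C± 3 x ∧ t))
                                     (W-coeff (≤-trans (+-monoˡ-≤ 4 (m∸n≤m N (E x))) N+4≤L)))
                               (∧∧-distrib-⨁ L (E x <ᵇ suc N) (C± 3 x) _)) ⟩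
  ⨁[ x < L ] ⨁[ y < L ]
    ((E x <ᵇ suc N) ∧ (C± 3 x ∧ ⨁[ z < L ] ((2 * E y + 4 * E z ≡ᵇ N ∸ E x) ∧ (C± 3 y ∧ C± 3 z))))
    ≡⟨ ⨁-cong L (λ x _ → ⨁-cong L (λ y _ →
         ∧-⨁-shift L (E x) N (C± 3 x) (λ z → 2 * E y + 4 * E z) (λ z → C± 3 y ∧ C± 3 z))) ⟩
  ⨁[ x < L ] ⨁[ y < L ] ⨁[ z < L ] ((E x + (2 * E y + 4 * E z) ≡ᵇ N) ∧ (C± 3 x ∧ (C± 3 y ∧ C± 3 z)))
    ≡⟨ ⨁-cong L (λ x _ → ⨁-cong L (λ y _ → ⨁-cong L (λ z _ → ∧-guard _ (as-squares x y z)))) ⟩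
  Q₁₂₄ L (7 * N + 63)
    ∎
  where
  open ≡-Reasoning
  as-squares : ∀ x y z → C± 3 x ∧ (C± 3 y ∧ C± 3 z) ≡ true →
               (E x + (2 * E y + 4 * E z) ≡ᵇ N) ≡ (x * x + 2 * (y * y) + 4 * (z * z) ≡ᵇ 7 * N + 63)
  as-squares x y z classes with ∧₃-true {C± 3 x} {C± 3 y} {C± 3 z} classes
  ... | Cx , Cy , Cz = sym (trans
    (cong (_≡ᵇ 7 * N + 63) (trans (cong₂ (λ s c → s + 4 * c)
                                         (cong₂ (λ a b → a + 2 * b) (C±3-square x Cx) (C±3-square y Cy))
                                         (C±3-square z Cz))
                                  (identity (E x) (E y) (E z))))
    (≡ᵇ-injective (λ m → 7 * m + 63) (*-cancelˡ-≡ _ _ 7 ∘ +-cancelʳ-≡ 63 _ _) (E x + (2 * E y + 4 * E z)) N))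
    where
    identity : ∀ a b c → 7 * a + 9 + 2 * (7 * b + 9) + 4 * (7 * c + 9) ≡ 7 * (a + (2 * b + 4 * c)) + 63
    identity = solve-∀

R₁₂ : ℕ → Bool
R₁₂ = R (C± 1) (C± 2) 0

V : Series
V μ = R₁₂ (7 * μ + 5)

θ⊛V : ∀ {L} m → 7 * m + 5 < L → (θ ⊛ V) m ≡ Q₃₁₂ L (7 * m + 14)
θ⊛V {L} m 7m+5<L = begin
  (θ ⊛ V) m
    ≡⟨ ⊛-family V (θ-family (≤-trans (+-mono-≤ (m≤n*m m 7) (n≤1+n 4)) (<⇒≤ 7m+5<L))) ⟩
  ⨁[ x < L ] ((E x <ᵇ suc m) ∧ (C± 3 x ∧ V (m ∸ E x)))
    ≡⟨ ⨁-cong L (λ x _ → trans (cong (λ t → (E x <ᵇ suc m) ∧ (C± 3 x ∧ t))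
                                     (R-bound (C± 1) (C± 2) 0 _ (V-bound x)))
                               (trans (∧∧-distrib-⨁ L (E x <ᵇ suc m) (C± 3 x) _)
                                      (⨁-cong L (λ u _ → ∧∧-distrib-⨁ L (E x <ᵇ suc m) (C± 3 x) _)))) ⟩
  ⨁[ x < L ] ⨁[ u < L ] ⨁[ w < L ]
    ((E x <ᵇ suc m) ∧ (C± 3 x ∧ ((u * u + w * w + 0 ≡ᵇ 7 * (m ∸ E x) + 5) ∧ (C± 1 u ∧ C± 2 w))))
    ≡⟨ ⨁-cong L (λ x _ → ⨁-cong L (λ u _ → ⨁-cong L (λ w _ →
         trans (combine x (u * u + w * w + 0) (C± 1 u ∧ C± 2 w))
               (cong (λ S → (x * x + S ≡ᵇ 7 * m + 14) ∧ (C± 3 x ∧ (C± 1 u ∧ C± 2 w)))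
                     (+-identityʳ (u * u + w * w)))))) ⟩
  Q₃₁₂ L (7 * m + 14)
    ∎
  where
  open ≡-Reasoning
  V-bound : ∀ x → suc (7 * (m ∸ E x) + 5) ≤ L
  V-bound x = ≤-<-trans (+-monoˡ-≤ 5 (*-monoʳ-≤ 7 (m∸n≤m m (E x)))) 7m+5<L
  combine : ∀ x S cl → (E x <ᵇ suc m) ∧ (C± 3 x ∧ ((S ≡ᵇ 7 * (m ∸ E x) + 5) ∧ cl)) ≡
                       (x * x + S ≡ᵇ 7 * m + 14) ∧ (C± 3 x ∧ cl)
  combine x S cl = begin
    (E x <ᵇ suc m) ∧ (C± 3 x ∧ ((S ≡ᵇ 7 * (m ∸ E x) + 5) ∧ cl))
      ≡⟨ ∧-shuffle (E x <ᵇ suc m) (C± 3 x) _ cl ⟩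
    ((E x <ᵇ suc m) ∧ (S ≡ᵇ 7 * (m ∸ E x) + 5)) ∧ (C± 3 x ∧ cl)
      ≡⟨ cong (_∧ (C± 3 x ∧ cl)) (≡ᵇ-shift-affine 7 9 5 (E x) m S (<ᵇ⇒< 5 7 _)) ⟩
    (7 * E x + 9 + S ≡ᵇ 7 * m + 14) ∧ (C± 3 x ∧ cl)
      ≡⟨ ∧-guard (C± 3 x ∧ cl) (λ Cx∧cl →
           cong (λ t → t + S ≡ᵇ 7 * m + 14) (sym (C±3-square x (∧-conicalˡ _ _ Cx∧cl)))) ⟩
    (x * x + S ≡ᵇ 7 * m + 14) ∧ (C± 3 x ∧ cl)
      ∎

cube-even-reduction : ∀ K →
  Q₁₂₄ (suc (2 * K) * 2) (8 * K) ≡ ⨁[ j < suc (2 * K) ] (C± 2 j ∧ R (C± 2) (C± 3) (2 * (j * j)) (2 * K))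
cube-even-reduction K = begin
  ⨁[ x < n * 2 ] ⨁[ y < n * 2 ] ⨁[ z < n * 2 ] F x y z
    ≡⟨ ⨁-even n _ x-odd ⟩
  ⨁[ k < n ] ⨁[ y < n * 2 ] ⨁[ z < n * 2 ] F (k * 2) y z
    ≡⟨ ⨁-cong n (λ k _ → ⨁-even n _ (y-odd k)) ⟩
  ⨁[ k < n ] ⨁[ j < n ] ⨁[ z < n * 2 ] F (k * 2) (j * 2) z
    ≡⟨ ⨁-comm n n _ ⟩
  ⨁[ j < n ] ⨁[ k < n ] ⨁[ z < n * 2 ] F (k * 2) (j * 2) z
    ≡⟨ ⨁-cong n (λ j _ → ⨁-cong n (λ k _ → ⨁-extend _ (m≤m*n n 2) (λ z n≤z _ → z-large j k z n≤z))) ⟩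
  ⨁[ j < n ] ⨁[ k < n ] ⨁[ z < n ] F (k * 2) (j * 2) z
    ≡⟨ ⨁-cong n (λ j _ → trans (⨁-cong n (λ k _ → ⨁-cong n (λ z _ → halve-term j k z)))
                               (sym (∧-distribˡ-⨁² n n (C± 2 j) _))) ⟩
  ⨁[ j < n ] (C± 2 j ∧ R (C± 2) (C± 3) (2 * (j * j)) (2 * K))
    ∎
  where
  open ≡-Reasoning
  open CommutativeMonoidSolver ∧-commutativeMonoid using (solve; _⊕_; _⊜_)
  n = suc (2 * K)
  F : ℕ → ℕ → ℕ → Bool
  F x y z = (x * x + 2 * (y * y) + 4 * (z * z) ≡ᵇ 8 * K) ∧ (C± 3 x ∧ (C± 3 y ∧ C± 3 z))
  x-odd : ∀ q → ⨁[ y < n * 2 ] ⨁[ z < n * 2 ] F (q * 2 + 1) y z ≡ false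
  x-odd q = ⨁-false (n * 2) λ y _ → ⨁-false (n * 2) λ z _ →
    cong (_∧ (C± 3 (q * 2 + 1) ∧ (C± 3 y ∧ C± 3 z))) (dec-false (_ ≟ 8 * K) λ eq →
      even≢odd (4 * K) (2 * (q * q) + 2 * q + y * y + 2 * (z * z)) (trans (eight K) (trans (sym eq) (shape q y z))))
    where
    eight : ∀ K → 2 * (4 * K) ≡ 8 * K
    eight = solve-∀
    shape : ∀ q y z → (q * 2 + 1) * (q * 2 + 1) + 2 * (y * y) + 4 * (z * z) ≡
                      suc (2 * (2 * (q * q) + 2 * q + y * y + 2 * (z * z)))
    shape = solve-∀
  y-odd : ∀ k q → ⨁[ z < n * 2 ] F (k * 2) (q * 2 + 1) z ≡ false
  y-odd k q = ⨁-false (n * 2) λ z _ →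
    cong (_∧ (C± 3 (k * 2) ∧ (C± 3 (q * 2 + 1) ∧ C± 3 z))) (dec-false (_ ≟ 8 * K) λ eq →
      even≢odd (2 * K) (k * k + 2 * (q * q) + 2 * q + z * z)
        (*-cancelˡ-≡ _ _ 2 (trans (eight K) (trans (sym eq) (shape k q z)))))
    where
    eight : ∀ K → 2 * (2 * (2 * K)) ≡ 8 * K
    eight = solve-∀
    shape : ∀ k q z → (k * 2) * (k * 2) + 2 * ((q * 2 + 1) * (q * 2 + 1)) + 4 * (z * z) ≡
                      2 * suc (2 * (k * k + 2 * (q * q) + 2 * q + z * z))
    shape = solve-∀
  quarter : ∀ j k z → ((k * 2) * (k * 2) + 2 * ((j * 2) * (j * 2)) + 4 * (z * z) ≡ᵇ 8 * K) ≡
                      (k * k + z * z + 2 * (j * j) ≡ᵇ 2 * K)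
  quarter j k z = trans (cong₂ _≡ᵇ_ (expand k j z) (eight K))
                        (≡ᵇ-injective (4 *_) (*-cancelˡ-≡ _ _ 4) (k * k + z * z + 2 * (j * j)) (2 * K))
    where
    expand : ∀ k j z → (k * 2) * (k * 2) + 2 * ((j * 2) * (j * 2)) + 4 * (z * z) ≡ 4 * (k * k + z * z + 2 * (j * j))
    expand = solve-∀
    eight : ∀ K → 8 * K ≡ 4 * (2 * K)
    eight = solve-∀
  halve-term : ∀ j k z →
               F (k * 2) (j * 2) z ≡ C± 2 j ∧ ((k * k + z * z + 2 * (j * j) ≡ᵇ 2 * K) ∧ (C± 2 k ∧ C± 3 z))
  halve-term j k z = begin
    F (k * 2) (j * 2) z
      ≡⟨ cong₂ _∧_ (quarter j k z) (cong₂ _∧_ (C±3-double k) (cong (_∧ C± 3 z) (C±3-double j))) ⟩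
    (k * k + z * z + 2 * (j * j) ≡ᵇ 2 * K) ∧ (C± 2 k ∧ (C± 2 j ∧ C± 3 z))
      ≡⟨ solve 4 (λ e a b c → e ⊕ (a ⊕ (b ⊕ c)) ⊜ b ⊕ (e ⊕ (a ⊕ c))) refl
               (k * k + z * z + 2 * (j * j) ≡ᵇ 2 * K) (C± 2 k) (C± 2 j) (C± 3 z) ⟩
    C± 2 j ∧ ((k * k + z * z + 2 * (j * j) ≡ᵇ 2 * K) ∧ (C± 2 k ∧ C± 3 z))
      ∎
  z-large : ∀ j k z → n ≤ z → F (k * 2) (j * 2) z ≡ false
  z-large j k z n≤z = trans (halve-term j k z) (trans
    (cong (λ b → C± 2 j ∧ (b ∧ (C± 2 k ∧ C± 3 z))) (squares-exceed {k} {z} (inj₂ n≤z)))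
    (∧-zeroʳ (C± 2 j)))

ternary-halving : ∀ K → Q₁₂₄ (suc (2 * K) * 2) (8 * K) ≡ Q₃₁₂ (suc K) K
ternary-halving K = begin
  Q₁₂₄ (suc (2 * K) * 2) (8 * K)
    ≡⟨ cube-even-reduction K ⟩
  ⨁[ j < suc (2 * K) ] (C± 2 j ∧ R (C± 2) (C± 3) (2 * (j * j)) (2 * K))
    ≡⟨ ⨁-cong (suc (2 * K)) (λ j _ → cong (C± 2 j ∧_) (halving halving₂₃ (j * j) K)) ⟩
  ⨁[ j < suc (2 * K) ] (C± 2 j ∧ R (C± 3) (C± 1) (j * j) K)
    ≡⟨ ⨁-extend _ (s≤s (m≤m+n K (K + 0))) (λ j K<j _ →
         trans (cong (C± 2 j ∧_) (j-large j K<j)) (∧-zeroʳ (C± 2 j))) ⟩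
  ⨁[ j < suc K ] (C± 2 j ∧ R (C± 3) (C± 1) (j * j) K)
    ≡⟨ ⨁-cong (suc K) (λ j _ → ∧-distribˡ-⨁² (suc K) (suc K) (C± 2 j) _) ⟩
  ⨁[ j < suc K ] ⨁[ u < suc K ] ⨁[ w < suc K ] (C± 2 j ∧ ((u * u + w * w + j * j ≡ᵇ K) ∧ (C± 3 u ∧ C± 1 w)))
    ≡⟨ ⨁-sink₃ (suc K) (suc K) (suc K) _ ⟩
  ⨁[ u < suc K ] ⨁[ w < suc K ] ⨁[ j < suc K ] (C± 2 j ∧ ((u * u + w * w + j * j ≡ᵇ K) ∧ (C± 3 u ∧ C± 1 w)))
    ≡⟨ ⨁-cong (suc K) (λ u _ → ⨁-cong (suc K) (λ w _ → ⨁-cong (suc K) (λ j _ → rename u w j))) ⟩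
  Q₃₁₂ (suc K) K
    ∎
  where
  open ≡-Reasoning
  open CommutativeMonoidSolver ∧-commutativeMonoid using (solve; _⊕_; _⊜_)
  j-large : ∀ j → K < j → R (C± 3) (C± 1) (j * j) K ≡ false
  j-large j K<j = ⨁-false (suc K) λ u _ → ⨁-false (suc K) λ w _ → cong (_∧ (C± 3 u ∧ C± 1 w))
    (dec-false (_ ≟ K) (>⇒≢ (<-≤-trans K<j (≤-trans (n≤n*n j) (m≤n+m (j * j) (u * u + w * w))))))
  rename : ∀ u w j → C± 2 j ∧ ((u * u + w * w + j * j ≡ᵇ K) ∧ (C± 3 u ∧ C± 1 w)) ≡
                     (u * u + (w * w + j * j) ≡ᵇ K) ∧ (C± 3 u ∧ (C± 1 w ∧ C± 2 j))
  rename u w j = trans (solve 4 (λ c e a b → c ⊕ (e ⊕ (a ⊕ b)) ⊜ e ⊕ (a ⊕ (b ⊕ c))) refl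
                               (C± 2 j) (u * u + w * w + j * j ≡ᵇ K) (C± 3 u) (C± 1 w))
                       (cong (λ t → (t ≡ᵇ K) ∧ (C± 3 u ∧ (C± 1 w ∧ C± 2 j))) (+-assoc (u * u) (w * w) (j * j)))

θ⊛W-section : ∀ μ → (θ ⊛ W) (8 * μ + 7) ≡ (θ ⊛ V) μ
θ⊛W-section μ = begin
  (θ ⊛ W) (8 * μ + 7)               ≡⟨ θ-cube (8 * μ + 7) cube-bound ⟩
  Q₁₂₄ L (7 * (8 * μ + 7) + 63)      ≡⟨ cong (Q₁₂₄ L) (target μ) ⟩
  Q₁₂₄ L (8 * K)                     ≡⟨ ternary-halving K ⟩
  Q₃₁₂ (suc K) K                     ≡⟨ θ⊛V μ (s≤s (+-monoʳ-≤ (7 * μ) (≤ᵇ⇒≤ 5 14 _))) ⟨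
  (θ ⊛ V) μ                          ∎
  where
  open ≡-Reasoning
  K = 7 * μ + 14
  L = suc (2 * K) * 2
  target : ∀ μ → 7 * (8 * μ + 7) + 63 ≡ 8 * (7 * μ + 14)
  target = solve-∀
  cube-bound : 8 * μ + 7 + 4 ≤ L
  cube-bound = subst (8 * μ + 7 + 4 ≤_) (gap μ) (m≤m+n (8 * μ + 7 + 4) (20 * μ + 47))
    where
    gap : ∀ μ → 8 * μ + 7 + 4 + (20 * μ + 47) ≡ suc (2 * (7 * μ + 14)) * 2
    gap = solve-∀


-- The progressions of even values

cMod2-section : ∀ μ → cMod2 13 1 (8 * μ + 7) ≡ V μ
cMod2-section = ⊛-cancelʳ {F = θ} θ-0 λ μ → begin
  (γ₇ ⊛ θ) μ                 ≡⟨ ⊛-comm γ₇ θ μ ⟩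
  (θ ⊛ γ₇) μ                 ≡⟨ dilate-⊛-section 8 7 μ θ γ ≤-refl ⟨
  (dilate 8 θ ⊛ γ) (8 * μ + 7) ≡⟨ ⊛-comm (dilate 8 θ) γ (8 * μ + 7) ⟩
  (γ ⊛ dilate 8 θ) (8 * μ + 7) ≡⟨ inverse-dilate₈ γ⊛θ≗𝟙 (8 * μ + 7) ⟩
  (θ ⊛ W) (8 * μ + 7)        ≡⟨ θ⊛W-section μ ⟩
  (θ ⊛ V) μ                  ≡⟨ ⊛-comm θ V μ ⟩
  (V ⊛ θ) μ                  ∎
  where
  open ≡-Reasoning
  γ γ₇ : Series
  γ = cMod2 13 1
  γ₇ j = γ (8 * j + 7)
  γ⊛θ≗𝟙 : γ ⊛ θ ≗ 𝟙
  γ⊛θ≗𝟙 n = trans (⊛-congˡ γ (λ i → sym (psiMod2≗θ i)) n) (cMod2-inverse 13 1 n)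

sum-of-two-squares-mod4 : ∀ u w → (u * u + w * w) % 4 ≢ 3
sum-of-two-squares-mod4 u w eq = residues (m%n<n u 4) (m%n<n w 4) (begin
  ((u % 4) * (u % 4) % 4 + (w % 4) * (w % 4) % 4) % 4
    ≡⟨ cong₂ (λ a b → (a + b) % 4) (%-distribˡ-* u u 4) (%-distribˡ-* w w 4) ⟨
  ((u * u) % 4 + (w * w) % 4) % 4                     ≡⟨ %-distribˡ-+ (u * u) (w * w) 4 ⟨
  (u * u + w * w) % 4                                 ≡⟨ eq ⟩
  3                                                   ∎)
  where
  open ≡-Reasoning
  residues : ∀ {r} → r < 4 → ∀ {s} → s < 4 → ((r * r) % 4 + (s * s) % 4) % 4 ≢ 3
  residues = toWitness {a? = allUpTo? (λ r → allUpTo? (λ s → ¬? (((r * r) % 4 + (s * s) % 4) % 4 ≟ 3)) 4) 4} _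

R-4t+3 : ∀ A B t → R A B 0 (4 * t + 3) ≡ false
R-4t+3 A B t = ⨁-false (suc (4 * t + 3)) λ u _ → ⨁-false (suc (4 * t + 3)) λ w _ →
  cong (_∧ (A u ∧ B w)) (dec-false (u * u + w * w + 0 ≟ 4 * t + 3) λ eq →
  sum-of-two-squares-mod4 u w (begin
    (u * u + w * w) % 4      ≡⟨ cong (_% 4) (trans (sym (+-identityʳ (u * u + w * w))) eq) ⟩
    (4 * t + 3) % 4          ≡⟨ cong (_% 4) (+-comm (4 * t) 3) ⟩
    (3 + 4 * t) % 4          ≡⟨ cong (λ m → (3 + m) % 4) (*-comm 4 t) ⟩
    (3 + t * 4) % 4          ≡⟨ [m+kn]%n≡m%n 3 t 4 ⟩
    3                        ∎))
  where open ≡-Reasoning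

R₁₂-vanishes : ∀ i t → R₁₂ (2 ^ i * (4 * t + 3)) ≡ false
R₁₂-vanishes zero                t = trans (cong R₁₂ (+-identityʳ (4 * t + 3))) (R-4t+3 (C± 1) (C± 2) t)
R₁₂-vanishes (suc zero)          t = trans (halving halving₁₂ 0 (4 * t + 3)) (R-4t+3 (C± 2) (C± 3) t)
R₁₂-vanishes (suc (suc zero))    t = begin
  R₁₂ (4 * (4 * t + 3))              ≡⟨ cong R₁₂ (four (4 * t + 3)) ⟩
  R₁₂ (2 * (2 * (4 * t + 3)))        ≡⟨ halving halving₁₂ 0 (2 * (4 * t + 3)) ⟩
  R (C± 2) (C± 3) 0 (2 * (4 * t + 3)) ≡⟨ halving halving₂₃ 0 (4 * t + 3) ⟩
  R (C± 3) (C± 1) 0 (4 * t + 3)      ≡⟨ R-4t+3 (C± 3) (C± 1) t ⟩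
  false                              ∎
  where
  open ≡-Reasoning
  four : ∀ Y → 4 * Y ≡ 2 * (2 * Y)
  four = solve-∀
R₁₂-vanishes (suc (suc (suc i))) t = begin
  R₁₂ (2 ^ (3 + i) * Y)                      ≡⟨ cong R₁₂ (eight (2 ^ i) Y) ⟩
  R₁₂ (2 * (2 * (2 * (2 ^ i * Y))))          ≡⟨ halving halving₁₂ 0 (2 * (2 * (2 ^ i * Y))) ⟩
  R (C± 2) (C± 3) 0 (2 * (2 * (2 ^ i * Y)))  ≡⟨ halving halving₂₃ 0 (2 * (2 ^ i * Y)) ⟩
  R (C± 3) (C± 1) 0 (2 * (2 ^ i * Y))        ≡⟨ halving halving₃₁ 0 (2 ^ i * Y) ⟩
  R₁₂ (2 ^ i * Y)                            ≡⟨ R₁₂-vanishes i t ⟩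
  false                                      ∎
  where
  open ≡-Reasoning
  Y = 4 * t + 3
  eight : ∀ P Y → 2 * (2 * (2 * P)) * Y ≡ 2 * (2 * (2 * (P * Y)))
  eight = solve-∀

c-even : ∀ μ j t → 7 * μ + 5 ≡ 2 ^ j * (4 * t + 3) → (+ 2) ∣ c 13 1 (8 * μ + 7)
c-even μ j t eq = odd-false⇒2∣ _ (begin
  cMod2 13 1 (8 * μ + 7)      ≡⟨ cMod2-section μ ⟩
  R₁₂ (7 * μ + 5)             ≡⟨ cong R₁₂ eq ⟩
  R₁₂ (2 ^ j * (4 * t + 3))   ≡⟨ R₁₂-vanishes j t ⟩
  false                       ∎)
  where open ≡-Reasoning

8^k%7≡1 : ∀ k → 8 ^ k % 7 ≡ 1
8^k%7≡1 zero    = refl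
8^k%7≡1 (suc k) = trans (%-distribˡ-* 8 (8 ^ k) 7) (cong (λ r → 1 * r % 7) (8^k%7≡1 k))

%7-period₃ : ∀ a k i → a * 2 ^ (3 * k + i) % 7 ≡ a * 2 ^ i % 7
%7-period₃ a k i = begin
  a * 2 ^ (3 * k + i) % 7            ≡⟨ cong (λ m → a * m % 7) (^-distribˡ-+-* 2 (3 * k) i) ⟩
  a * (2 ^ (3 * k) * 2 ^ i) % 7      ≡⟨ cong (λ m → a * (m * 2 ^ i) % 7) (^-*-assoc 2 3 k) ⟨
  a * (8 ^ k * 2 ^ i) % 7            ≡⟨ cong (_% 7) (rearrange a (8 ^ k) (2 ^ i)) ⟩
  a * 2 ^ i * 8 ^ k % 7              ≡⟨ %-distribˡ-* (a * 2 ^ i) (8 ^ k) 7 ⟩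
  (a * 2 ^ i % 7) * (8 ^ k % 7) % 7  ≡⟨ cong (λ r → (a * 2 ^ i % 7) * r % 7) (8^k%7≡1 k) ⟩
  (a * 2 ^ i % 7) * 1 % 7            ≡⟨ cong (_% 7) (*-identityʳ (a * 2 ^ i % 7)) ⟩
  a * 2 ^ i % 7 % 7                  ≡⟨ m%n%n≡m%n (a * 2 ^ i) 7 ⟩
  a * 2 ^ i % 7                      ∎
  where
  open ≡-Reasoning
  rearrange : ∀ a b c → a * (b * c) ≡ a * c * b
  rearrange = solve-∀

c-even-progression : ∀ k i a → a * 2 ^ i % 7 ≡ 5 → a % 4 ≡ 3 → ∀ n →
  (+ 2) ∣ c 13 1 (2 ^ (3 * k + (i + 5)) * n + (a * 2 ^ (3 * k + (i + 3)) + 9) / 7)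
c-even-progression k i a a2ⁱ%7≡5 a%4≡3 n =
  subst (λ N → (+ 2) ∣ c 13 1 N) (sym N≡8μ+7) (c-even μ (3 * k + i) (7 * n + s) 7μ+5≡)
  where
  open ≡-Reasoning
  P e s μ : ℕ
  P = 2 ^ (3 * k + i)
  e = a * P / 7
  s = a / 4
  μ = 4 * P * n + e
  aP≡7e+5 : a * P ≡ 7 * e + 5
  aP≡7e+5 = %-decompose {a * P} 7 (trans (%7-period₃ a k i) a2ⁱ%7≡5)
  2^[3k+i+_] : ∀ j → 2 ^ (3 * k + (i + j)) ≡ P * 2 ^ j
  2^[3k+i+ j ] = trans (cong (2 ^_) (sym (+-assoc (3 * k) i j))) (^-distribˡ-+-* 2 (3 * k + i) j)
  N≡8μ+7 : 2 ^ (3 * k + (i + 5)) * n + (a * 2 ^ (3 * k + (i + 3)) + 9) / 7 ≡ 8 * μ + 7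
  N≡8μ+7 = begin
    2 ^ (3 * k + (i + 5)) * n + (a * 2 ^ (3 * k + (i + 3)) + 9) / 7
      ≡⟨ cong₂ (λ p q → p * n + (a * q + 9) / 7) 2^[3k+i+ 5 ] 2^[3k+i+ 3 ] ⟩
    P * 32 * n + (a * (P * 8) + 9) / 7
      ≡⟨ cong (λ m → P * 32 * n + m) (exact-div (8 * e + 7) 7 (begin
           a * (P * 8) + 9      ≡⟨ numerator a P ⟩
           8 * (a * P) + 9      ≡⟨ cong (λ m → 8 * m + 9) aP≡7e+5 ⟩
           8 * (7 * e + 5) + 9  ≡⟨ multiple e ⟩
           (8 * e + 7) * 7      ∎)) ⟩
    P * 32 * n + (8 * e + 7)
      ≡⟨ shape P n e ⟩
    8 * μ + 7
      ∎
    where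
    numerator : ∀ a P → a * (P * 8) + 9 ≡ 8 * (a * P) + 9
    numerator = solve-∀
    multiple : ∀ e → 8 * (7 * e + 5) + 9 ≡ (8 * e + 7) * 7
    multiple = solve-∀
    shape : ∀ P n e → P * 32 * n + (8 * e + 7) ≡ 8 * (4 * P * n + e) + 7
    shape = solve-∀
  7μ+5≡ : 7 * μ + 5 ≡ P * (4 * (7 * n + s) + 3)
  7μ+5≡ = begin
    7 * (4 * P * n + e) + 5        ≡⟨ expand P n e ⟩
    28 * P * n + (7 * e + 5)       ≡⟨ cong (λ m → 28 * P * n + m) aP≡7e+5 ⟨
    28 * P * n + a * P             ≡⟨ cong (λ b → 28 * P * n + b * P) (%-decompose {a} 4 a%4≡3) ⟩
    28 * P * n + (4 * s + 3) * P   ≡⟨ collect P n s ⟩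
    P * (4 * (7 * n + s) + 3)      ∎
    where
    expand : ∀ P n e → 7 * (4 * P * n + e) + 5 ≡ 28 * P * n + (7 * e + 5)
    expand = solve-∀
    collect : ∀ P n s → 28 * P * n + (4 * s + 3) * P ≡ P * (4 * (7 * n + s) + 3)
    collect = solve-∀

theorem4p1 : (n k : ℕ) →
    ((+ 2) ∣ c 13 1 (2 ^ (3 * k + 5) * n + (19 * 2 ^ (3 * k + 3) + 9) / 7))
    × ((+ 2) ∣ c 13 1 (2 ^ (3 * k + 6) * n + (27 * 2 ^ (3 * k + 4) + 9) / 7))
    × ((+ 2) ∣ c 13 1 (2 ^ (3 * k + 7) * n + (3 * 2 ^ (3 * k + 5) + 9) / 7))
theorem4p1 n k =
  c-even-progression k 0 19 refl refl n ,
  c-even-progression k 1 27 refl refl n ,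
  c-even-progression k 2 3 refl refl n
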